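{- For every integer $n\ge 0$, \[ \tilde{\mathrm{err}}(n,0)\equiv E(n)\pmod{\mathrm{Ker}(L)},\qquad \tilde{\mathrm{err}}(n,1)\equiv S_{ -1}(E(n))\pmod{\mathrm{Ker}(L)}, \] where $E(n)=\sum_{T\in\mathrm{RV}_{n;2}}\mathrm{sgn}(T)\,\tilde h_{\mathrm{val}(T)}\in\tilde{\mathrm{CH}}_2$, and $\tilde{\mathrm{err}}(n,0),\tilde{\mathrm{err}}(n,1)\in\tilde{\mathrm{CH}}_2$ are defined recursively by $\tilde{\mathrm{err}}(0,0)=\tilde h_2$, $\tilde{\mathrm{err}}(0,1)=\tilde h_1$ and \[ \tilde{\mathrm{err}}(n+1,0)=\big(\tilde{\mathrm{err}}(n,0)^2-\tilde{\mathrm{err}}(n,1)^2\big)\tilde{\mathrm{err}}(n,0), \] \[ \tilde{\mathrm{err}}(n+1,1)=\big(2\,\tilde{\mathrm{err}}(n,0)^2-\tilde h_1\,\tilde{\mathrm{err}}(n,1)\,\tilde{\mathrm{err}}(n,0)\big)\tilde{\mathrm{err}}(n,1). \]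
   Context: Let $\tau:\mathbb{Z}\to\mathbb{Z}$, $\tau(i)=|i+1|-1$. The ring $\tilde{\mathrm{CH}}_2$ is generated by elements $\tilde h_i$, $i\in\mathbb{Z}$; its elements are finite integer linear combinations of the (linearly independent) symbols $\tilde h_i$, and multiplication is the $\mathbb{Z}$-bilinear extension of the rules: $\tilde h_{ -1}\tilde h_j=0$; $\tilde h_i\tilde h_j=\sum_{k=0}^{i}\tilde h_{j-i+2k}$ if $i\ge 0$; $\tilde h_i\tilde h_j=-\tilde h_{\tau(i)}\tilde h_j$ if $i<-1$. The ring $\mathrm{CH}_2$ has as elements finite integer linear combinations of linearly independent symbols $h_i$, $i\ge 0$ (with $h_ih_j=\sum_{k=0}^{\min(i,j)}h_{|j-i|+2k}$). $L:\tilde{\mathrm{CH}}_2\to\mathrm{CH}_2$ is the linear map (a ring homomorphism) with $L(\tilde h_i)=\mathrm{sgn}(i+1)h_{\tau(i)}$ (so $L(\tilde h_{ -1})=0$), and $\mathrm{Ker}(L)$ is its kernel. For $k\in\mathbb{Z}$, $S_k$ is the linear operator on $\tilde{\mathrm{CH}}_2$ with $S_k(\tilde h_i)=\tilde h_{i+k}$. Radius-value trees: a radius-value tree of height $0$ is a single vertex labeled by an even integer; its value is that label. A radius-value tree of height $n+1$ is a 4-tuple $T=(l,T_1,T_2,T_3)$ where $l$ is an even integer, $T_1,T_2,T_3$ are radius-value trees of height $n$ (children of the root, in this order, forming a rooted plane ternary tree), and $|l-\mathrm{val}(T_1)-\mathrm{val}(T_3)|\le\tau(\mathrm{val}(T_2))$;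 the value is $\mathrm{val}(T)=l$. The sign is $\mathrm{sgn}(T)=1$ for height $0$ and otherwise $\mathrm{sgn}(T)=\mathrm{sgn}(\mathrm{val}(T_2)+1)\mathrm{sgn}(T_1)\mathrm{sgn}(T_2)\mathrm{sgn}(T_3)$. $\mathrm{RV}_{n;2}$ is the set of radius-value trees of height $n$ all of whose leaves have label $2$. -}

module Defs where

open import Data.Nat as ℕ using (ℕ; zero; suc)
open import Data.Integer as ℤ using (ℤ; +_; -[1+_]; _+_; _-_; _*_; -_; ∣_∣; _≤_; 0ℤ; 1ℤ)
open import Data.List using (List; []; _∷_; map; _++_; concatMap; upTo; foldr)
open import Data.List.Membership.Propositional using (_∈_)
open import Data.List.Relation.Unary.Unique.Propositional using (Unique)
open import Data.Product using (_×_; _,_; ∃)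
open import Data.Bool using (if_then_else_)
open import Relation.Nullary.Decidable using (⌊_⌋)
open import Relation.Binary.PropositionalEquality using (_≡_)
open import Function.Bundles using (_⇔_)

τ : ℤ → ℤ
τ i = + ∣ i + 1ℤ ∣ - 1ℤ

sgn : ℤ → ℤ
sgn (+ zero)  = 0ℤ
sgn (+ suc _) = 1ℤ
sgn -[1+ _ ]  = - 1ℤ

-- The ring CH̃₂: finite integer linear combinations of symbols h̃_i (i ∈ ℤ),
-- represented as formal sums: a list of (coefficient , index) pairs,
-- standing for Σ coefficient · h̃_index.

CHt : Set
CHt = List (ℤ × ℤ)

ht : ℤ → CHt
ht i = (1ℤ , i) ∷ []

zeroCHt : CHt
zeroCHt = []

_⊕_ : CHt → CHt → CHt
x ⊕ y = x ++ y

scale : ℤ → CHt → CHt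
scale c = map (λ { (d , i) → (c * d , i) })

⊖_ : CHt → CHt
⊖ x = scale (- 1ℤ) x

_⊝_ : CHt → CHt → CHt
x ⊝ y = x ⊕ (⊖ y)

hmul : ℤ → ℤ → CHt
hmul (+ n) j = map (λ k → (1ℤ , j - + n + + (2 ℕ.* k))) (upTo (suc n))
hmul -[1+ zero ] j = []
-- i < -1 : - h̃_{τ(i)} h̃_j   (here i = -(n+2), τ(i) = n)
hmul -[1+ suc n ] j = ⊖ hmul (+ n) j

_⊗_ : CHt → CHt → CHt
x ⊗ y = concatMap (λ { (c , i) → concatMap (λ { (d , j) → scale (c * d) (hmul i j) }) y }) x

S : ℤ → CHt → CHt
S k = map (λ { (c , i) → (c , i + k) })

CH : Set
CH = List (ℤ × ℕ)

coeff : CH → ℕ → ℤ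
coeff x m = foldr (λ { (c , k) acc → (if ⌊ k ℕ.≟ m ⌋ then c else 0ℤ) + acc }) 0ℤ x

-- L(h̃_i) = sgn(i+1) h_{τ(i)}.  For i = -1 the coefficient sgn(0) = 0, so the
-- (natural-number) index used there, |i+1| ∸ 1 = 0, is irrelevant.
L : CHt → CH
L = map (λ { (c , i) → (c * sgn (i + 1ℤ) , ∣ i + 1ℤ ∣ ℕ.∸ 1) })

KerL : CHt → Set
KerL x = ∀ m → coeff (L x) m ≡ 0ℤ

_≡[KerL]_ : CHt → CHt → Set
x ≡[KerL] y = KerL (x ⊝ y)

err : ℕ → CHt × CHt
err zero = (ht (+ 2) , ht (+ 1))
err (suc n) with err n
... | (e0 , e1) =
  ( ((e0 ⊗ e0) ⊝ (e1 ⊗ e1)) ⊗ e0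
  , ((scale (+ 2) (e0 ⊗ e0)) ⊝ ((ht (+ 1) ⊗ e1) ⊗ e0)) ⊗ e1 )

err0 : ℕ → CHt
err0 n = Data.Product.proj₁ (err n)

err1 : ℕ → CHt
err1 n = Data.Product.proj₂ (err n)

data Tree : Set where
  leaf : ℤ → Tree
  node : ℤ → Tree → Tree → Tree → Tree

val : Tree → ℤ
val (leaf l) = l
val (node l _ _ _) = l

Even : ℤ → Set
Even z = ∃ λ k → z ≡ + 2 * k

data IsRV : ℕ → Tree → Set where
  rv-leaf : ∀ {l} → Even l → IsRV zero (leaf l)
  rv-node : ∀ {n l T₁ T₂ T₃} → Even l →
            IsRV n T₁ → IsRV n T₂ → IsRV n T₃ →
            + ∣ l - val T₁ - val T₃ ∣ ≤ τ (val T₂) →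
            IsRV (suc n) (node l T₁ T₂ T₃)

data Leaves2 : Tree → Set where
  lv-leaf : Leaves2 (leaf (+ 2))
  lv-node : ∀ {l T₁ T₂ T₃} → Leaves2 T₁ → Leaves2 T₂ → Leaves2 T₃ →
            Leaves2 (node l T₁ T₂ T₃)

RV2 : ℕ → Tree → Set
RV2 n T = IsRV n T × Leaves2 T

sgnT : Tree → ℤ
sgnT (leaf _) = 1ℤ
sgnT (node _ T₁ T₂ T₃) = sgn (val T₂ + 1ℤ) * sgnT T₁ * sgnT T₂ * sgnT T₃

Enumerates : ℕ → List Tree → Set
Enumerates n ts = Unique ts × (∀ T → (T ∈ ts) ⇔ RV2 n T)

Esum : List Tree → CHt
Esum ts = map (λ T → (sgnT T , val T)) ts

-- Pair x = Σ cᵢ h̃ᵢ with a function g : ℤ → ℤ by ⟪ x , g ⟫ = Σ cᵢ g(i). Since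
-- L(h̃₋₂₋ᵢ) = −L(h̃ᵢ), the coefficient functionals of L are skew for the reflection
-- i ↦ −2 − i, so x ≡ y modulo Ker L as soon as x and y agree on every skew g (x ≈ y).
-- This relation is a congruence for the product, and modulo it the product is
-- commutative and satisfies (h̃ᵢh̃ⱼ)h̃ₖ = h̃ⱼ(h̃ᵢh̃ₖ). Both follow from the rule
-- h̃ᵢh̃ⱼ = h̃ᵢ₋₁h̃ⱼ₋₁ + h̃ᵢ₊ⱼ, which makes the relevant differences invariant under
-- (i , j) ↦ (i − 1 , j − 1), so that they only need to be checked on a single row.
-- Writing E = E(n) and h̃ᵢ ⊛ h̃ⱼ = h̃ᵢ₊ⱼ, the same rule turns the recursion into
-- err̃(n+1,0) ≈ E(E ⊛ E) and err̃(n+1,1) ≈ S₋₁(E(E ⊛ E)), given err̃(n,0) ≈ E and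
-- err̃(n,1) ≈ S₋₁E. Finally E(E ⊛ E) = Σ sgn T₁ sgn T₂ sgn T₃ h̃_{val T₂} h̃_{val T₁ + val T₃},
-- and expanding each product lists exactly the admissible root labels over the
-- children T₁, T₂, T₃, with sign sgn(val T₂ + 1); hence E(E ⊛ E) = E(n+1).

{-# OPTIONS --safe #-}
module Submission where

open import Defs
open import Level using (0ℓ)
open import Function using (_∘_)
open import Function.Bundles using (_⇔_; mk⇔; Equivalence)
open import Data.Bool using (true; false; if_then_else_)
open import Data.Product using (_×_; _,_; ∃; ∃-syntax)
open import Data.Sum using (inj₁; inj₂)
open import Data.Nat as ℕ using (ℕ; zero; suc; s≤s)
import Data.Nat.Properties as ℕ
open import Data.Integer as ℤ using (ℤ; +_; -[1+_]; _+_; _-_; _*_; -_; ∣_∣; 0ℤ; 1ℤ)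
import Data.Integer.Properties as ℤ
open import Data.Integer.Tactic.RingSolver using (solve-∀)
open import Data.List using (List; []; _∷_; _∷ʳ_; map; _++_; concatMap; upTo; applyUpTo; cartesianProduct)
open import Data.List.Properties using (map-upTo; upTo-∷ʳ; map-∘; map-cong; map-++)
open import Data.List.Relation.Unary.All as All using ()
open import Data.List.Relation.Unary.Any using (here)
open import Data.List.Relation.Unary.AllPairs using ([]; _∷_)
open import Data.List.Relation.Unary.Unique.Propositional using (Unique)
import Data.List.Relation.Unary.Unique.Propositional.Properties as UP
open import Data.List.Membership.Propositional using (_∈_; find; lose)
open import Data.List.Membership.Propositional.Properties
  using (∈-map⁺; ∈-map⁻; ∈-upTo⁺; ∈-upTo⁻; ∈-concatMap⁺; ∈-concatMap⁻; ∈-cartesianProduct⁺; ∈-cartesianProduct⁻)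
open import Data.List.Membership.Propositional.Properties.WithK using (unique∧set⇒bag)
open import Data.List.Relation.Binary.BagAndSetEquality using (∼bag⇒↭)
open import Data.List.Relation.Binary.Permutation.Propositional as ↭ using (_↭_)
open import Relation.Nullary.Decidable using (⌊_⌋)
open import Relation.Binary.PropositionalEquality
open import Relation.Binary.Bundles using (Setoid)
open import Algebra.Bundles using (AbelianGroup)
import Algebra.Properties.CommutativeSemigroup as CommSemigroupProperties
import Algebra.Properties.Group as GroupProperties

private
  module +-Group = GroupProperties (AbelianGroup.group ℤ.+-0-abelianGroup)
  module +-CS = CommSemigroupProperties ℤ.+-commutativeSemigroup
  module *-CS = CommSemigroupProperties ℤ.*-commutativeSemigroup

∑ : {A : Set} → List A → (A → ℤ) → ℤ
∑ []       f = 0ℤ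
∑ (x ∷ xs) f = f x + ∑ xs f

infix 5 ∑
syntax ∑ xs (λ x → e) = ∑[ x ∈ xs ] e

module _ {A : Set} where

  ∑-cong : ∀ xs {f g : A → ℤ} → (∀ x → f x ≡ g x) → ∑ xs f ≡ ∑ xs g
  ∑-cong []       f≗g = refl
  ∑-cong (x ∷ xs) f≗g = cong₂ _+_ (f≗g x) (∑-cong xs f≗g)

  ∑-zero : (xs : List A) → ∑[ x ∈ xs ] 0ℤ ≡ 0ℤ
  ∑-zero []       = refl
  ∑-zero (x ∷ xs) = trans (ℤ.+-identityˡ _) (∑-zero xs)

  ∑-+ : ∀ xs (f g : A → ℤ) → ∑[ x ∈ xs ] (f x + g x) ≡ ∑ xs f + ∑ xs g
  ∑-+ []       f g = refl
  ∑-+ (x ∷ xs) f g =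
    trans (cong (_+_ (f x + g x)) (∑-+ xs f g)) (+-CS.interchange (f x) (g x) (∑ xs f) (∑ xs g))

  ∑-*ˡ : ∀ xs c (f : A → ℤ) → ∑[ x ∈ xs ] (c * f x) ≡ c * ∑ xs f
  ∑-*ˡ []       c f = sym (ℤ.*-zeroʳ c)
  ∑-*ˡ (x ∷ xs) c f = trans (cong (_+_ (c * f x)) (∑-*ˡ xs c f)) (sym (ℤ.*-distribˡ-+ c (f x) (∑ xs f)))

  ∑-neg : ∀ xs (f : A → ℤ) → ∑[ x ∈ xs ] (- f x) ≡ - ∑ xs f
  ∑-neg []       f = refl
  ∑-neg (x ∷ xs) f = trans (cong (_+_ (- f x)) (∑-neg xs f)) (sym (ℤ.neg-distrib-+ (f x) (∑ xs f)))

  ∑-++ : ∀ xs ys (f : A → ℤ) → ∑ (xs ++ ys) f ≡ ∑ xs f + ∑ ys f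
  ∑-++ []       ys f = sym (ℤ.+-identityˡ _)
  ∑-++ (x ∷ xs) ys f = trans (cong (_+_ (f x)) (∑-++ xs ys f)) (sym (ℤ.+-assoc (f x) _ _))

  ∑-∷ʳ : ∀ xs y (f : A → ℤ) → ∑ (xs ∷ʳ y) f ≡ ∑ xs f + f y
  ∑-∷ʳ xs y f = trans (∑-++ xs (y ∷ []) f) (cong (_+_ (∑ xs f)) (ℤ.+-identityʳ (f y)))

  ∑-↭ : ∀ {xs ys} (f : A → ℤ) → xs ↭ ys → ∑ xs f ≡ ∑ ys f
  ∑-↭ f ↭.refl             = refl
  ∑-↭ f (↭.prep x p)       = cong (_+_ (f x)) (∑-↭ f p)
  ∑-↭ f (↭.swap x y p)     = trans (cong (λ s → f x + (f y + s)) (∑-↭ f p)) (+-CS.x∙yz≈y∙xz (f x) (f y) _)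
  ∑-↭ f (↭.trans p q)      = trans (∑-↭ f p) (∑-↭ f q)

module _ {A B : Set} where

  ∑-map : ∀ (h : A → B) xs (f : B → ℤ) → ∑ (map h xs) f ≡ ∑ xs (f ∘ h)
  ∑-map h []       f = refl
  ∑-map h (x ∷ xs) f = cong (_+_ (f (h x))) (∑-map h xs f)

  ∑-concatMap : ∀ (h : A → List B) xs (f : B → ℤ) → ∑ (concatMap h xs) f ≡ ∑[ x ∈ xs ] ∑ (h x) f
  ∑-concatMap h []       f = refl
  ∑-concatMap h (x ∷ xs) f =
    trans (∑-++ (h x) (concatMap h xs) f) (cong (_+_ (∑ (h x) f)) (∑-concatMap h xs f))

  ∑-comm : ∀ (xs : List A) (ys : List B) (f : A → B → ℤ) →
           ∑[ x ∈ xs ] ∑[ y ∈ ys ] f x y ≡ ∑[ y ∈ ys ] ∑[ x ∈ xs ] f x y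
  ∑-comm []       ys f = sym (∑-zero ys)
  ∑-comm (x ∷ xs) ys f =
    trans (cong (_+_ (∑ ys (f x))) (∑-comm xs ys f)) (sym (∑-+ ys (f x) (λ y → ∑[ x ∈ xs ] f x y)))

∑-cartesianProduct : ∀ {A B : Set} xs ys (f : A × B → ℤ) →
                     ∑ (cartesianProduct xs ys) f ≡ ∑[ x ∈ xs ] ∑[ y ∈ ys ] f (x , y)
∑-cartesianProduct []       ys f = refl
∑-cartesianProduct (x ∷ xs) ys f = begin
  ∑ (map (x ,_) ys ++ cartesianProduct xs ys) f            ≡⟨ ∑-++ (map (x ,_) ys) _ f ⟩
  ∑ (map (x ,_) ys) f + ∑ (cartesianProduct xs ys) f       ≡⟨ cong₂ _+_ (∑-map (x ,_) ys f) (∑-cartesianProduct xs ys f) ⟩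
  (∑[ y ∈ ys ] f (x , y)) + (∑[ x ∈ xs ] ∑[ y ∈ ys ] f (x , y)) ∎
  where open ≡-Reasoning

-- Elements of CH̃₂ as linear forms on functions ℤ → ℤ

⟪_,_⟫ : CHt → (ℤ → ℤ) → ℤ
⟪ x , g ⟫ = ∑ x (λ (c , i) → c * g i)

module _ (x : CHt) where

  pair-congʳ : ∀ {g h : ℤ → ℤ} → (∀ i → g i ≡ h i) → ⟪ x , g ⟫ ≡ ⟪ x , h ⟫
  pair-congʳ g≗h = ∑-cong x (λ (c , i) → cong (c *_) (g≗h i))

  pair-+ʳ : ∀ (g h : ℤ → ℤ) → ⟪ x , (λ i → g i + h i) ⟫ ≡ ⟪ x , g ⟫ + ⟪ x , h ⟫
  pair-+ʳ g h = trans (∑-cong x (λ (c , i) → ℤ.*-distribˡ-+ c (g i) (h i))) (∑-+ x _ _)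

  pair-negʳ : ∀ (g : ℤ → ℤ) → ⟪ x , (λ i → - g i) ⟫ ≡ - ⟪ x , g ⟫
  pair-negʳ g = trans (∑-cong x (λ (c , i) → sym (ℤ.neg-distribʳ-* c (g i)))) (∑-neg x _)

  pair--ʳ : ∀ (g h : ℤ → ℤ) → ⟪ x , (λ i → g i - h i) ⟫ ≡ ⟪ x , g ⟫ - ⟪ x , h ⟫
  pair--ʳ g h = trans (pair-+ʳ g (λ i → - h i)) (cong (_+_ ⟪ x , g ⟫) (pair-negʳ h))

pair-comm : ∀ x y (H : ℤ → ℤ → ℤ) →
            ⟪ x , (λ i → ⟪ y , H i ⟫) ⟫ ≡ ⟪ y , (λ j → ⟪ x , (λ i → H i j) ⟫) ⟫
pair-comm x y H = begin
  ∑ x (λ (c , i) → c * ∑ y (λ (d , j) → d * H i j))   ≡⟨ ∑-cong x (λ (c , i) → sym (∑-*ˡ y c _)) ⟩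
  ∑ x (λ (c , i) → ∑ y (λ (d , j) → c * (d * H i j))) ≡⟨ ∑-comm x y _ ⟩
  ∑ y (λ (d , j) → ∑ x (λ (c , i) → c * (d * H i j))) ≡⟨ ∑-cong y (λ (d , j) → pull d j) ⟩
  ∑ y (λ (d , j) → d * ∑ x (λ (c , i) → c * H i j))   ∎
  where
  open ≡-Reasoning
  pull : ∀ d j → ∑ x (λ (c , i) → c * (d * H i j)) ≡ d * ∑ x (λ (c , i) → c * H i j)
  pull d j = trans (∑-cong x (λ (c , i) → *-CS.x∙yz≈y∙xz c d (H i j))) (∑-*ˡ x d _)

pair-⊕ : ∀ x y g → ⟪ x ⊕ y , g ⟫ ≡ ⟪ x , g ⟫ + ⟪ y , g ⟫
pair-⊕ x y g = ∑-++ x y _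

pair-scale : ∀ a x g → ⟪ scale a x , g ⟫ ≡ a * ⟪ x , g ⟫
pair-scale a x g =
  trans (∑-map _ x _) (trans (∑-cong x (λ (c , i) → ℤ.*-assoc a c (g i))) (∑-*ˡ x a _))

pair-⊖ : ∀ x g → ⟪ ⊖ x , g ⟫ ≡ - ⟪ x , g ⟫
pair-⊖ x g = trans (pair-scale (- 1ℤ) x g) (ℤ.-1*i≡-i _)

pair-⊝ : ∀ x y g → ⟪ x ⊝ y , g ⟫ ≡ ⟪ x , g ⟫ - ⟪ y , g ⟫
pair-⊝ x y g =
  trans (pair-⊕ x (⊖ y) g) (cong (_+_ ⟪ x , g ⟫) (trans (pair-scale (- 1ℤ) y g) (ℤ.-1*i≡-i _)))

pair-S : ∀ k x g → ⟪ S k x , g ⟫ ≡ ⟪ x , (λ i → g (i + k)) ⟫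
pair-S k x g = ∑-map _ x _

pair-ht : ∀ i g → ⟪ ht i , g ⟫ ≡ g i
pair-ht i g = trans (ℤ.+-identityʳ _) (ℤ.*-identityˡ (g i))

bilinear : (ℤ → ℤ → CHt) → CHt → CHt → CHt
bilinear m x y = concatMap (λ (c , i) → concatMap (λ (d , j) → scale (c * d) (m i j)) y) x

pair-bilinear : ∀ m x y g → ⟪ bilinear m x y , g ⟫ ≡ ⟪ x , (λ i → ⟪ y , (λ j → ⟪ m i j , g ⟫) ⟫) ⟫
pair-bilinear m x y g = trans (∑-concatMap _ x _) (∑-cong x λ (c , i) → begin
  ⟪ concatMap (λ (d , j) → scale (c * d) (m i j)) y , g ⟫ ≡⟨ ∑-concatMap _ y _ ⟩
  ∑ y (λ (d , j) → ⟪ scale (c * d) (m i j) , g ⟫) ≡⟨ ∑-cong y (λ (d , j) → trans (pair-scale (c * d) (m i j) g) (ℤ.*-assoc c d _)) ⟩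
  ∑ y (λ (d , j) → c * (d * ⟪ m i j , g ⟫))       ≡⟨ ∑-*ˡ y c _ ⟩
  c * ⟪ y , (λ j → ⟪ m i j , g ⟫) ⟫               ∎)
  where open ≡-Reasoning

_⊛_ : CHt → CHt → CHt
_⊛_ = bilinear (λ i j → ht (i + j))

pair-⊛ : ∀ x y g → ⟪ x ⊛ y , g ⟫ ≡ ⟪ x , (λ i → ⟪ y , (λ j → g (i + j)) ⟫) ⟫
pair-⊛ x y g =
  trans (pair-bilinear (λ i j → ht (i + j)) x y g) (pair-congʳ x (λ i → pair-congʳ y (λ j → pair-ht (i + j) g)))

-- g ⟦ i · j ⟧ is g evaluated on h̃ᵢh̃ⱼ, so (λ m → g ⟦ m · k ⟧) ⟦ i · j ⟧ is g on (h̃ᵢh̃ⱼ)h̃ₖ.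
_⟦_·_⟧ : (ℤ → ℤ) → ℤ → ℤ → ℤ
g ⟦ i · j ⟧ = ⟪ hmul i j , g ⟫

pair-⊗ : ∀ x y g → ⟪ x ⊗ y , g ⟫ ≡ ⟪ x , (λ i → ⟪ y , (λ j → g ⟦ i · j ⟧) ⟫) ⟫
pair-⊗ = pair-bilinear hmul

-- Structure constants of the product

window : ℤ → ℕ → List ℤ
window j t = map (λ k → j - + t + + (2 ℕ.* k)) (upTo (suc t))

⟦+·⟧≡∑window : ∀ g t j → g ⟦ + t · j ⟧ ≡ ∑ (window j t) g
⟦+·⟧≡∑window g t j = begin
  ⟪ map (λ k → 1ℤ , idx k) (upTo (suc t)) , g ⟫  ≡⟨ ∑-map (λ k → 1ℤ , idx k) (upTo (suc t)) (λ (c , i) → c * g i) ⟩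
  ∑ (upTo (suc t)) (λ k → 1ℤ * g (idx k))        ≡⟨ ∑-cong (upTo (suc t)) {λ k → 1ℤ * g (idx k)} (λ k → ℤ.*-identityˡ (g (idx k))) ⟩
  ∑ (upTo (suc t)) (g ∘ idx)                      ≡⟨ ∑-map idx (upTo (suc t)) g ⟨
  ∑ (window j t) g                                ∎
  where
  open ≡-Reasoning
  idx : ℕ → ℤ
  idx k = j - + t + + (2 ℕ.* k)

window-suc-front : ∀ j t → window j (suc t) ≡ (j - + suc t) ∷ window (j + 1ℤ) t
window-suc-front j t = cong₂ _∷_ (ℤ.+-identityʳ _) (begin
  map f (applyUpTo suc (suc t))   ≡⟨ cong (map f) (map-upTo suc (suc t)) ⟨
  map f (map suc (upTo (suc t)))  ≡⟨ map-∘ (upTo (suc t)) ⟨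
  map (f ∘ suc) (upTo (suc t))    ≡⟨ map-cong shift (upTo (suc t)) ⟩
  window (j + 1ℤ) t               ∎)
  where
  open ≡-Reasoning
  f : ℕ → ℤ
  f k = j - + suc t + + (2 ℕ.* k)
  shift : ∀ k → f (suc k) ≡ j + 1ℤ - + t + + (2 ℕ.* k)
  shift k rewrite ℤ.pos-* 2 (suc k) | ℤ.pos-* 2 k = ring j (+ t) (+ k)
    where ring : ∀ j t k → j - (1ℤ + t) + + 2 * (1ℤ + k) ≡ j + 1ℤ - t + + 2 * k
          ring = solve-∀

window-suc-back : ∀ j t → window j (suc t) ≡ window (j - 1ℤ) t ∷ʳ (j + + suc t)
window-suc-back j t = begin
  map f (upTo (suc (suc t)))         ≡⟨ cong (map f) (upTo-∷ʳ (suc t)) ⟨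
  map f (upTo (suc t) ∷ʳ suc t)      ≡⟨ map-++ f (upTo (suc t)) (suc t ∷ []) ⟩
  map f (upTo (suc t)) ∷ʳ f (suc t)  ≡⟨ cong₂ _∷ʳ_ (map-cong shift (upTo (suc t))) last ⟩
  window (j - 1ℤ) t ∷ʳ (j + + suc t) ∎
  where
  open ≡-Reasoning
  f : ℕ → ℤ
  f k = j - + suc t + + (2 ℕ.* k)
  shift : ∀ k → f k ≡ j - 1ℤ - + t + + (2 ℕ.* k)
  shift k rewrite ℤ.pos-* 2 k = ring j (+ t) (+ k)
    where ring : ∀ j t k → j - (1ℤ + t) + + 2 * k ≡ j - 1ℤ - t + + 2 * k
          ring = solve-∀
  last : f (suc t) ≡ j + + suc t
  last rewrite ℤ.pos-* 2 (suc t) = ring j (+ t)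
    where ring : ∀ j t → j - (1ℤ + t) + + 2 * (1ℤ + t) ≡ j + (1ℤ + t)
          ring = solve-∀

window-+ : ∀ j s t → window (j + s) t ≡ map (_+ s) (window j t)
window-+ j s t = trans (map-cong shift (upTo (suc t))) (map-∘ (upTo (suc t)))
  where
  shift : ∀ k → j + s - + t + + (2 ℕ.* k) ≡ j - + t + + (2 ℕ.* k) + s
  shift k = ring j s (+ t) (+ (2 ℕ.* k))
    where ring : ∀ j s t m → j + s - t + m ≡ j - t + m + s
          ring = solve-∀

⟦0·⟧ : ∀ g j → g ⟦ 0ℤ · j ⟧ ≡ g j
⟦0·⟧ g j = trans (⟦+·⟧≡∑window g 0 j) (trans (ℤ.+-identityʳ _) (cong g (trans (ℤ.+-identityʳ _) (ℤ.+-identityʳ j))))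

⟦suc·⟧-front : ∀ g t j → g ⟦ + suc t · j ⟧ ≡ g (j - + suc t) + g ⟦ + t · j + 1ℤ ⟧
⟦suc·⟧-front g t j = begin
  g ⟦ + suc t · j ⟧                              ≡⟨ ⟦+·⟧≡∑window g (suc t) j ⟩
  ∑ (window j (suc t)) g                         ≡⟨ cong (λ w → ∑ w g) (window-suc-front j t) ⟩
  g (j - + suc t) + ∑ (window (j + 1ℤ) t) g      ≡⟨ cong (_+_ (g (j - + suc t))) (⟦+·⟧≡∑window g t (j + 1ℤ)) ⟨
  g (j - + suc t) + g ⟦ + t · j + 1ℤ ⟧           ∎
  where open ≡-Reasoning

⟦suc·⟧-back : ∀ g t j → g ⟦ + suc t · j ⟧ ≡ g ⟦ + t · j - 1ℤ ⟧ + g (j + + suc t)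
⟦suc·⟧-back g t j = begin
  g ⟦ + suc t · j ⟧                              ≡⟨ ⟦+·⟧≡∑window g (suc t) j ⟩
  ∑ (window j (suc t)) g                         ≡⟨ cong (λ w → ∑ w g) (window-suc-back j t) ⟩
  ∑ (window (j - 1ℤ) t ∷ʳ (j + + suc t)) g       ≡⟨ ∑-∷ʳ (window (j - 1ℤ) t) (j + + suc t) g ⟩
  ∑ (window (j - 1ℤ) t) g + g (j + + suc t)      ≡⟨ cong (_+ g (j + + suc t)) (⟦+·⟧≡∑window g t (j - 1ℤ)) ⟨
  g ⟦ + t · j - 1ℤ ⟧ + g (j + + suc t)           ∎
  where open ≡-Reasoning

⟦1·⟧ : ∀ g j → g ⟦ 1ℤ · j ⟧ ≡ g (j - 1ℤ) + g (j + 1ℤ)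
⟦1·⟧ g j = trans (⟦suc·⟧-front g 0 j) (cong (_+_ (g (j - 1ℤ))) (⟦0·⟧ g (j + 1ℤ)))

⟦-[1+suc]·⟧ : ∀ g t j → g ⟦ -[1+ suc t ] · j ⟧ ≡ - g ⟦ + t · j ⟧
⟦-[1+suc]·⟧ g t j = pair-⊖ (hmul (+ t) j) g

⟦·⟧-shift : ∀ g s i j → (λ m → g (m + s)) ⟦ i · j ⟧ ≡ g ⟦ i · j + s ⟧
⟦·⟧-shift g s (+ t) j = begin
  (λ m → g (m + s)) ⟦ + t · j ⟧        ≡⟨ ⟦+·⟧≡∑window (λ m → g (m + s)) t j ⟩
  ∑ (window j t) (λ m → g (m + s))     ≡⟨ ∑-map (_+ s) (window j t) g ⟨
  ∑ (map (_+ s) (window j t)) g        ≡⟨ cong (λ w → ∑ w g) (window-+ j s t) ⟨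
  ∑ (window (j + s) t) g               ≡⟨ ⟦+·⟧≡∑window g t (j + s) ⟨
  g ⟦ + t · j + s ⟧                    ∎
  where open ≡-Reasoning
⟦·⟧-shift g s -[1+ zero ]  j = refl
⟦·⟧-shift g s -[1+ suc t ] j = begin
  (λ m → g (m + s)) ⟦ -[1+ suc t ] · j ⟧ ≡⟨ ⟦-[1+suc]·⟧ (λ m → g (m + s)) t j ⟩
  - (λ m → g (m + s)) ⟦ + t · j ⟧        ≡⟨ cong -_ (⟦·⟧-shift g s (+ t) j) ⟩
  - g ⟦ + t · j + s ⟧                    ≡⟨ ⟦-[1+suc]·⟧ g t (j + s) ⟨
  g ⟦ -[1+ suc t ] · j + s ⟧             ∎
  where open ≡-Reasoning

⟦·⟧-top : ∀ g i j → g ⟦ i · j ⟧ ≡ g ⟦ i - 1ℤ · j - 1ℤ ⟧ + g (i + j)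
⟦·⟧-top g (+ zero) j =
  trans (⟦0·⟧ g j) (sym (trans (ℤ.+-identityˡ _) (cong g (ℤ.+-identityˡ j))))
⟦·⟧-top g (+ suc t) j =
  trans (⟦suc·⟧-back g t j) (cong (_+_ (g ⟦ + t · j - 1ℤ ⟧)) (cong g (ℤ.+-comm j (+ suc t))))
⟦·⟧-top g -[1+ zero ] j = sym (begin
  g ⟦ -[1+ 1 ] · j - 1ℤ ⟧ + g (- 1ℤ + j) ≡⟨ cong₂ _+_ (⟦-[1+suc]·⟧ g 0 (j - 1ℤ)) (cong g (ℤ.+-comm (- 1ℤ) j)) ⟩
  - g ⟦ 0ℤ · j - 1ℤ ⟧ + g (j - 1ℤ)        ≡⟨ cong (λ a → - a + g (j - 1ℤ)) (⟦0·⟧ g (j - 1ℤ)) ⟩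
  - g (j - 1ℤ) + g (j - 1ℤ)               ≡⟨ ℤ.+-inverseˡ (g (j - 1ℤ)) ⟩
  0ℤ                                  ∎)
  where open ≡-Reasoning
⟦·⟧-top g -[1+ suc t ] j = sym (begin
  g ⟦ -[1+ suc t ] - 1ℤ · j - 1ℤ ⟧ + g (-[1+ suc t ] + j)
    ≡⟨ cong (λ n → g ⟦ -[1+ suc n ] · j - 1ℤ ⟧ + g (-[1+ suc t ] + j)) (ℕ.+-identityʳ (suc t)) ⟩
  g ⟦ -[1+ suc (suc t) ] · j - 1ℤ ⟧ + g (-[1+ suc t ] + j)
    ≡⟨ cong (_+ g (-[1+ suc t ] + j)) (⟦-[1+suc]·⟧ g (suc t) (j - 1ℤ)) ⟩
  - g ⟦ + suc t · j - 1ℤ ⟧ + g (-[1+ suc t ] + j)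
    ≡⟨ cong (λ a → - a + g (-[1+ suc t ] + j)) (⟦suc·⟧-front g t (j - 1ℤ)) ⟩
  - (g (j - 1ℤ - + suc t) + g ⟦ + t · j - 1ℤ + 1ℤ ⟧) + g (-[1+ suc t ] + j)
    ≡⟨ cong₂ (λ a b → - (g a + g ⟦ + t · b ⟧) + g (-[1+ suc t ] + j)) (ring₁ j (+ t)) (ring₂ j) ⟩
  - (g (-[1+ suc t ] + j) + g ⟦ + t · j ⟧) + g (-[1+ suc t ] + j)
    ≡⟨ ring₃ (g (-[1+ suc t ] + j)) (g ⟦ + t · j ⟧) ⟩
  - g ⟦ + t · j ⟧
    ≡⟨ ⟦-[1+suc]·⟧ g t j ⟨
  g ⟦ -[1+ suc t ] · j ⟧ ∎)
  where
  open ≡-Reasoning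
  ring₁ : ∀ j t → j - 1ℤ - (1ℤ + t) ≡ - (1ℤ + (1ℤ + t)) + j
  ring₁ = solve-∀
  ring₂ : ∀ j → j - 1ℤ + 1ℤ ≡ j
  ring₂ = solve-∀
  ring₃ : ∀ a b → - (a + b) + a ≡ - b
  ring₃ = solve-∀

⟦·⟧-top′ : ∀ g i j {i′ j′ m} → i - 1ℤ ≡ i′ → j - 1ℤ ≡ j′ → i + j ≡ m → g ⟦ i · j ⟧ ≡ g ⟦ i′ · j′ ⟧ + g m
⟦·⟧-top′ g i j refl refl refl = ⟦·⟧-top g i j

module _ (W : ℤ → ℤ → ℤ) (invariant : ∀ i j → W i j ≡ W (i - 1ℤ) (j - 1ℤ)) where

  diagonal-shiftℕ : ∀ n i j → W i j ≡ W (i - + n) (j - + n)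
  diagonal-shiftℕ zero    i j = sym (cong₂ W (ℤ.+-identityʳ i) (ℤ.+-identityʳ j))
  diagonal-shiftℕ (suc n) i j = begin
    W i j                            ≡⟨ diagonal-shiftℕ n i j ⟩
    W (i - + n) (j - + n)            ≡⟨ invariant (i - + n) (j - + n) ⟩
    W (i - + n - 1ℤ) (j - + n - 1ℤ)  ≡⟨ cong₂ W (ring i (+ n)) (ring j (+ n)) ⟩
    W (i - + suc n) (j - + suc n)    ∎
    where
    open ≡-Reasoning
    ring : ∀ i n → i - n - 1ℤ ≡ i - (1ℤ + n)
    ring = solve-∀

  diagonal-shift : ∀ d i j → W i j ≡ W (i - d) (j - d)
  diagonal-shift (+ n)    = diagonal-shiftℕ n
  diagonal-shift -[1+ n ] i j = sym (begin
    W (i + + suc n) (j + + suc n)                  ≡⟨ diagonal-shiftℕ (suc n) _ _ ⟩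
    W (i + + suc n - + suc n) (j + + suc n - + suc n) ≡⟨ cong₂ W (ring i (+ suc n)) (ring j (+ suc n)) ⟩
    W i j                                          ∎)
    where
    open ≡-Reasoning
    ring : ∀ i m → i + m - m ≡ i
    ring = solve-∀

  zero-row⇒zero : ∀ c → (∀ j → W c j ≡ 0ℤ) → ∀ i j → W i j ≡ 0ℤ
  zero-row⇒zero c W[c,_]≡0 i j = begin
    W i j                           ≡⟨ diagonal-shift (i - c) i j ⟩
    W (i - (i - c)) (j - (i - c))   ≡⟨ cong (λ a → W a (j - (i - c))) (ring i c) ⟩
    W c (j - (i - c))               ≡⟨ W[c,_]≡0 (j - (i - c)) ⟩
    0ℤ                              ∎
    where
    open ≡-Reasoning
    ring : ∀ i c → i - (i - c) ≡ c
    ring = solve-∀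

-- (h̃₁h̃ᵢ)h̃ₖ = h̃ᵢ(h̃₁h̃ₖ), the base case of ⟦·⟧-assoc.
⟦·⟧-h₁ : ∀ g i k → g ⟦ i - 1ℤ · k ⟧ + g ⟦ i + 1ℤ · k ⟧ ≡ g ⟦ i · k - 1ℤ ⟧ + g ⟦ i · k + 1ℤ ⟧
⟦·⟧-h₁ g i k = ℤ.i-j≡0⇒i≡j _ _ (zero-row⇒zero W invariant 0ℤ row₀ i k)
  where
  W : ℤ → ℤ → ℤ
  W i k = (g ⟦ i - 1ℤ · k ⟧ + g ⟦ i + 1ℤ · k ⟧) - (g ⟦ i · k - 1ℤ ⟧ + g ⟦ i · k + 1ℤ ⟧)

  invariant : ∀ i k → W i k ≡ W (i - 1ℤ) (k - 1ℤ)
  invariant i k = begin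
    W i k
      ≡⟨ cong₂ _-_ (cong₂ _+_ (⟦·⟧-top g (i - 1ℤ) k) (⟦·⟧-top′ g (i + 1ℤ) k (ring₁ i) refl refl))
                   (cong₂ _+_ (⟦·⟧-top′ g i (k - 1ℤ) refl refl (ring₂ i k)) (⟦·⟧-top′ g i (k + 1ℤ) refl (ring₁ k) (ring₃ i k))) ⟩
    (a + x + (b + y)) - (c + x + (d + y))  ≡⟨ ring₄ a b c d x y ⟩
    W (i - 1ℤ) (k - 1ℤ)                    ∎
    where
    open ≡-Reasoning
    a b c d x y : ℤ
    a = g ⟦ i - 1ℤ - 1ℤ · k - 1ℤ ⟧
    b = g ⟦ i - 1ℤ + 1ℤ · k - 1ℤ ⟧
    c = g ⟦ i - 1ℤ · k - 1ℤ - 1ℤ ⟧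
    d = g ⟦ i - 1ℤ · k - 1ℤ + 1ℤ ⟧
    x = g (i - 1ℤ + k)
    y = g (i + 1ℤ + k)
    ring₁ : ∀ i → i + 1ℤ - 1ℤ ≡ i - 1ℤ + 1ℤ
    ring₁ = solve-∀
    ring₂ : ∀ i k → i + (k - 1ℤ) ≡ i - 1ℤ + k
    ring₂ = solve-∀
    ring₃ : ∀ i k → i + (k + 1ℤ) ≡ i + 1ℤ + k
    ring₃ = solve-∀
    ring₄ : ∀ a b c d x y → (a + x + (b + y)) - (c + x + (d + y)) ≡ (a + b) - (c + d)
    ring₄ = solve-∀

  row₀ : ∀ k → W 0ℤ k ≡ 0ℤ
  row₀ k = begin
    (0ℤ + g ⟦ 1ℤ · k ⟧) - (g ⟦ 0ℤ · k - 1ℤ ⟧ + g ⟦ 0ℤ · k + 1ℤ ⟧)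
      ≡⟨ cong₂ (λ a b → (0ℤ + a) - b) (⟦1·⟧ g k) (cong₂ _+_ (⟦0·⟧ g (k - 1ℤ)) (⟦0·⟧ g (k + 1ℤ))) ⟩
    (0ℤ + (g (k - 1ℤ) + g (k + 1ℤ))) - (g (k - 1ℤ) + g (k + 1ℤ))
      ≡⟨ ring (g (k - 1ℤ) + g (k + 1ℤ)) ⟩
    0ℤ ∎
    where
    open ≡-Reasoning
    ring : ∀ a → (0ℤ + a) - a ≡ 0ℤ
    ring = solve-∀

⟦·⟧-recurrence : ∀ g t j →
  g ⟦ + suc (suc t) · j ⟧ ≡ g ⟦ + suc t · j - 1ℤ ⟧ + g ⟦ + suc t · j + 1ℤ ⟧ - g ⟦ + t · j ⟧
⟦·⟧-recurrence g t j = begin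
  g ⟦ + suc (suc t) · j ⟧                           ≡⟨ cong (λ n → g ⟦ + n · j ⟧) (ℕ.+-comm 1 (suc t)) ⟩
  g ⟦ + suc t + 1ℤ · j ⟧                            ≡⟨ ring (g ⟦ + t · j ⟧) _ ⟩
  g ⟦ + t · j ⟧ + g ⟦ + suc t + 1ℤ · j ⟧ - g ⟦ + t · j ⟧ ≡⟨ cong (_- g ⟦ + t · j ⟧) (⟦·⟧-h₁ g (+ suc t) j) ⟩
  g ⟦ + suc t · j - 1ℤ ⟧ + g ⟦ + suc t · j + 1ℤ ⟧ - g ⟦ + t · j ⟧ ∎
  where
  open ≡-Reasoning
  ring : ∀ a b → b ≡ a + b - a
  ring = solve-∀

module _ (g : ℤ → ℤ) where

  ⟦+·⟧-assoc : ∀ t j k → (λ m → g ⟦ m · k ⟧) ⟦ + t · j ⟧ ≡ (λ m → g ⟦ j · m ⟧) ⟦ + t · k ⟧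
  ⟦+·⟧-assoc zero j k = trans (⟦0·⟧ (λ m → g ⟦ m · k ⟧) j) (sym (⟦0·⟧ (λ m → g ⟦ j · m ⟧) k))
  ⟦+·⟧-assoc (suc zero) j k = begin
    (λ m → g ⟦ m · k ⟧) ⟦ 1ℤ · j ⟧          ≡⟨ ⟦1·⟧ (λ m → g ⟦ m · k ⟧) j ⟩
    g ⟦ j - 1ℤ · k ⟧ + g ⟦ j + 1ℤ · k ⟧     ≡⟨ ⟦·⟧-h₁ g j k ⟩
    g ⟦ j · k - 1ℤ ⟧ + g ⟦ j · k + 1ℤ ⟧     ≡⟨ ⟦1·⟧ (λ m → g ⟦ j · m ⟧) k ⟨
    (λ m → g ⟦ j · m ⟧) ⟦ 1ℤ · k ⟧          ∎
    where open ≡-Reasoning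
  ⟦+·⟧-assoc (suc (suc t)) j k = begin
    Lhs (suc (suc t)) j                                      ≡⟨ ⟦·⟧-recurrence (λ m → g ⟦ m · k ⟧) t j ⟩
    Lhs (suc t) (j - 1ℤ) + Lhs (suc t) (j + 1ℤ) - Lhs t j
      ≡⟨ cong₂ _-_ (cong₂ _+_ (⟦+·⟧-assoc (suc t) (j - 1ℤ) k) (⟦+·⟧-assoc (suc t) (j + 1ℤ) k)) (⟦+·⟧-assoc t j k) ⟩
    Rhs (suc t) (j - 1ℤ) k + Rhs (suc t) (j + 1ℤ) k - Rhs t j k  ≡⟨ cong (_- Rhs t j k) middle ⟩
    Rhs (suc t) j (k - 1ℤ) + Rhs (suc t) j (k + 1ℤ) - Rhs t j k  ≡⟨ ⟦·⟧-recurrence (λ m → g ⟦ j · m ⟧) t k ⟨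
    Rhs (suc (suc t)) j k                                    ∎
    where
    open ≡-Reasoning
    Lhs : ℕ → ℤ → ℤ
    Lhs t j = (λ m → g ⟦ m · k ⟧) ⟦ + t · j ⟧
    Rhs : ℕ → ℤ → ℤ → ℤ
    Rhs t j k = (λ m → g ⟦ j · m ⟧) ⟦ + t · k ⟧
    middle : Rhs (suc t) (j - 1ℤ) k + Rhs (suc t) (j + 1ℤ) k ≡ Rhs (suc t) j (k - 1ℤ) + Rhs (suc t) j (k + 1ℤ)
    middle = begin
      Rhs (suc t) (j - 1ℤ) k + Rhs (suc t) (j + 1ℤ) k
        ≡⟨ pair-+ʳ (hmul (+ suc t) k) (λ m → g ⟦ j - 1ℤ · m ⟧) (λ m → g ⟦ j + 1ℤ · m ⟧) ⟨
      (λ m → g ⟦ j - 1ℤ · m ⟧ + g ⟦ j + 1ℤ · m ⟧) ⟦ + suc t · k ⟧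
        ≡⟨ pair-congʳ (hmul (+ suc t) k) (⟦·⟧-h₁ g j) ⟩
      (λ m → g ⟦ j · m - 1ℤ ⟧ + g ⟦ j · m + 1ℤ ⟧) ⟦ + suc t · k ⟧
        ≡⟨ pair-+ʳ (hmul (+ suc t) k) (λ m → g ⟦ j · m - 1ℤ ⟧) (λ m → g ⟦ j · m + 1ℤ ⟧) ⟩
      (λ m → g ⟦ j · m - 1ℤ ⟧) ⟦ + suc t · k ⟧ + (λ m → g ⟦ j · m + 1ℤ ⟧) ⟦ + suc t · k ⟧
        ≡⟨ cong₂ _+_ (⟦·⟧-shift (λ m → g ⟦ j · m ⟧) (- 1ℤ) (+ suc t) k) (⟦·⟧-shift (λ m → g ⟦ j · m ⟧) 1ℤ (+ suc t) k) ⟩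
      Rhs (suc t) j (k - 1ℤ) + Rhs (suc t) j (k + 1ℤ) ∎

  ⟦·⟧-assoc : ∀ i j k → (λ m → g ⟦ m · k ⟧) ⟦ i · j ⟧ ≡ (λ m → g ⟦ j · m ⟧) ⟦ i · k ⟧
  ⟦·⟧-assoc (+ t)        j k = ⟦+·⟧-assoc t j k
  ⟦·⟧-assoc -[1+ zero ]  j k = refl
  ⟦·⟧-assoc -[1+ suc t ] j k = begin
    (λ m → g ⟦ m · k ⟧) ⟦ -[1+ suc t ] · j ⟧ ≡⟨ ⟦-[1+suc]·⟧ (λ m → g ⟦ m · k ⟧) t j ⟩
    - (λ m → g ⟦ m · k ⟧) ⟦ + t · j ⟧        ≡⟨ cong -_ (⟦+·⟧-assoc t j k) ⟩
    - (λ m → g ⟦ j · m ⟧) ⟦ + t · k ⟧        ≡⟨ ⟦-[1+suc]·⟧ (λ m → g ⟦ j · m ⟧) t k ⟨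
    (λ m → g ⟦ j · m ⟧) ⟦ -[1+ suc t ] · k ⟧ ∎
    where open ≡-Reasoning

-- reflect i = −2 − i (reflect-≡), defined by cases so that hmul (reflect i) j unfolds.
reflect : ℤ → ℤ
reflect (+ n)          = -[1+ suc n ]
reflect -[1+ zero ]    = -[1+ zero ]
reflect -[1+ suc n ]   = + n

reflect-≡ : ∀ i → reflect i ≡ -[1+ 1 ] - i
reflect-≡ (+ zero)     = refl
reflect-≡ (+ suc n)    = refl
reflect-≡ -[1+ zero ]  = refl
reflect-≡ -[1+ suc n ] = refl

reflect-- : ∀ j m → reflect j - m ≡ reflect (j + m)
reflect-- j m rewrite reflect-≡ j | reflect-≡ (j + m) = ring j m
  where ring : ∀ j m → -[1+ 1 ] - j - m ≡ -[1+ 1 ] - (j + m)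
        ring = solve-∀

reflect-+ : ∀ j m → reflect j + m ≡ reflect (j - m)
reflect-+ j m rewrite reflect-≡ j | reflect-≡ (j - m) = ring j m
  where ring : ∀ j m → -[1+ 1 ] - j + m ≡ -[1+ 1 ] - (j - m)
        ring = solve-∀

reflect-+1 : ∀ i → reflect i + 1ℤ ≡ - (i + 1ℤ)
reflect-+1 i = trans (cong (_+ 1ℤ) (reflect-≡ i)) (ring i)
  where ring : ∀ i → -[1+ 1 ] - i + 1ℤ ≡ - (i + 1ℤ)
        ring = solve-∀

Skew : (ℤ → ℤ) → Set
Skew g = ∀ i → g (reflect i) ≡ - g i

⟦reflect·⟧ : ∀ g i j → g ⟦ reflect i · j ⟧ ≡ - g ⟦ i · j ⟧
⟦reflect·⟧ g (+ t)         j = ⟦-[1+suc]·⟧ g t j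
⟦reflect·⟧ g -[1+ zero ]   j = refl
⟦reflect·⟧ g -[1+ suc t ]  j = sym (trans (cong -_ (⟦-[1+suc]·⟧ g t j)) (ℤ.neg-involutive _))

x≡-x⇒x≡0 : ∀ {x} → x ≡ - x → x ≡ 0ℤ
x≡-x⇒x≡0 {+ zero}   _  = refl
x≡-x⇒x≡0 {+ suc n}  ()
x≡-x⇒x≡0 { -[1+ n ]} ()

module _ {g : ℤ → ℤ} (skew : Skew g) where

  ⟦+·reflect⟧ : ∀ t j → g ⟦ + t · reflect j ⟧ ≡ - g ⟦ + t · j ⟧
  ⟦+·reflect⟧ zero j = trans (⟦0·⟧ g (reflect j)) (trans (skew j) (cong -_ (sym (⟦0·⟧ g j))))
  ⟦+·reflect⟧ (suc t) j = begin
    g ⟦ + suc t · reflect j ⟧                          ≡⟨ ⟦suc·⟧-front g t (reflect j) ⟩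
    g (reflect j - + suc t) + g ⟦ + t · reflect j + 1ℤ ⟧
      ≡⟨ cong₂ (λ a b → g a + g ⟦ + t · b ⟧) (reflect-- j (+ suc t)) (reflect-+ j 1ℤ) ⟩
    g (reflect (j + + suc t)) + g ⟦ + t · reflect (j - 1ℤ) ⟧
      ≡⟨ cong₂ _+_ (skew (j + + suc t)) (⟦+·reflect⟧ t (j - 1ℤ)) ⟩
    - g (j + + suc t) + - g ⟦ + t · j - 1ℤ ⟧           ≡⟨ ring (g (j + + suc t)) (g ⟦ + t · j - 1ℤ ⟧) ⟩
    - (g ⟦ + t · j - 1ℤ ⟧ + g (j + + suc t))           ≡⟨ cong -_ (⟦suc·⟧-back g t j) ⟨
    - g ⟦ + suc t · j ⟧                                ∎
    where
    open ≡-Reasoning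
    ring : ∀ a b → - a + - b ≡ - (b + a)
    ring = solve-∀

  ⟦·reflect⟧ : ∀ i j → g ⟦ i · reflect j ⟧ ≡ - g ⟦ i · j ⟧
  ⟦·reflect⟧ (+ t)        j = ⟦+·reflect⟧ t j
  ⟦·reflect⟧ -[1+ zero ]  j = refl
  ⟦·reflect⟧ -[1+ suc t ] j = begin
    g ⟦ -[1+ suc t ] · reflect j ⟧ ≡⟨ ⟦-[1+suc]·⟧ g t (reflect j) ⟩
    - g ⟦ + t · reflect j ⟧        ≡⟨ cong -_ (⟦+·reflect⟧ t j) ⟩
    - - g ⟦ + t · j ⟧              ≡⟨ cong -_ (⟦-[1+suc]·⟧ g t j) ⟨
    - g ⟦ -[1+ suc t ] · j ⟧       ∎
    where open ≡-Reasoning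

  ⟦·-1⟧ : ∀ i → g ⟦ i · - 1ℤ ⟧ ≡ 0ℤ
  ⟦·-1⟧ i = x≡-x⇒x≡0 (⟦·reflect⟧ i (- 1ℤ))

  ⟦·⟧-comm : ∀ i j → g ⟦ i · j ⟧ ≡ g ⟦ j · i ⟧
  ⟦·⟧-comm i j = ℤ.i-j≡0⇒i≡j _ _ (zero-row⇒zero W invariant (- 1ℤ) row₋₁ i j)
    where
    W : ℤ → ℤ → ℤ
    W i j = g ⟦ i · j ⟧ - g ⟦ j · i ⟧

    invariant : ∀ i j → W i j ≡ W (i - 1ℤ) (j - 1ℤ)
    invariant i j = begin
      g ⟦ i · j ⟧ - g ⟦ j · i ⟧
        ≡⟨ cong₂ _-_ (⟦·⟧-top g i j) (⟦·⟧-top′ g j i refl refl (ℤ.+-comm j i)) ⟩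
      (g ⟦ i - 1ℤ · j - 1ℤ ⟧ + g (i + j)) - (g ⟦ j - 1ℤ · i - 1ℤ ⟧ + g (i + j))
        ≡⟨ ring (g ⟦ i - 1ℤ · j - 1ℤ ⟧) (g ⟦ j - 1ℤ · i - 1ℤ ⟧) (g (i + j)) ⟩
      W (i - 1ℤ) (j - 1ℤ) ∎
      where
      open ≡-Reasoning
      ring : ∀ a b x → (a + x) - (b + x) ≡ a - b
      ring = solve-∀

    row₋₁ : ∀ j → W (- 1ℤ) j ≡ 0ℤ
    row₋₁ j = trans (ℤ.+-identityˡ _) (cong -_ (⟦·-1⟧ j))

-- Congruence modulo Ker L

infix 4 _≃_ _≈_

record _≃_ (x y : CHt) : Set where
  constructor mk≃
  field ≃-pair : ∀ g → ⟪ x , g ⟫ ≡ ⟪ y , g ⟫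
open _≃_

record _≈_ (x y : CHt) : Set where
  constructor mk≈
  field ≈-pair : ∀ g → Skew g → ⟪ x , g ⟫ ≡ ⟪ y , g ⟫
open _≈_

≃⇒≈ : ∀ {x y} → x ≃ y → x ≈ y
≃⇒≈ x≃y = mk≈ (λ g _ → ≃-pair x≃y g)

≈-setoid : Setoid 0ℓ 0ℓ
≈-setoid = record
  { Carrier       = CHt
  ; _≈_           = _≈_
  ; isEquivalence = record
    { refl  = mk≈ (λ _ _ → refl)
    ; sym   = λ x≈y → mk≈ (λ g sk → sym (≈-pair x≈y g sk))
    ; trans = λ x≈y y≈z → mk≈ (λ g sk → trans (≈-pair x≈y g sk) (≈-pair y≈z g sk))
    }
  }

module ≈ = Setoid ≈-setoid

sgn-neg : ∀ x → sgn (- x) ≡ - sgn x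
sgn-neg (+ zero)  = refl
sgn-neg (+ suc n) = refl
sgn-neg -[1+ n ]  = refl

coeffL : ℕ → ℤ → ℤ
coeffL m i = if ⌊ ∣ i + 1ℤ ∣ ℕ.∸ 1 ℕ.≟ m ⌋ then sgn (i + 1ℤ) else 0ℤ

coeff-L : ∀ x m → coeff (L x) m ≡ ⟪ x , coeffL m ⟫
coeff-L []            m = refl
coeff-L ((c , i) ∷ x) m = cong₂ _+_ head (coeff-L x m)
  where
  head : (if ⌊ ∣ i + 1ℤ ∣ ℕ.∸ 1 ℕ.≟ m ⌋ then c * sgn (i + 1ℤ) else 0ℤ) ≡ c * coeffL m i
  head with ⌊ ∣ i + 1ℤ ∣ ℕ.∸ 1 ℕ.≟ m ⌋
  ... | true  = refl
  ... | false = sym (ℤ.*-zeroʳ c)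

coeffL-skew : ∀ m → Skew (coeffL m)
coeffL-skew m i rewrite reflect-+1 i | ℤ.∣-i∣≡∣i∣ (i + 1ℤ) | sgn-neg (i + 1ℤ) with ⌊ ∣ i + 1ℤ ∣ ℕ.∸ 1 ℕ.≟ m ⌋
... | true  = refl
... | false = refl

≈⇒≡[KerL] : ∀ {x y} → x ≈ y → x ≡[KerL] y
≈⇒≡[KerL] {x} {y} x≈y m = begin
  coeff (L (x ⊝ y)) m                   ≡⟨ coeff-L (x ⊝ y) m ⟩
  ⟪ x ⊝ y , coeffL m ⟫                  ≡⟨ pair-⊝ x y (coeffL m) ⟩
  ⟪ x , coeffL m ⟫ - ⟪ y , coeffL m ⟫   ≡⟨ cong (_- ⟪ y , coeffL m ⟫) (≈-pair x≈y (coeffL m) (coeffL-skew m)) ⟩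
  ⟪ y , coeffL m ⟫ - ⟪ y , coeffL m ⟫   ≡⟨ ℤ.+-inverseʳ ⟪ y , coeffL m ⟫ ⟩
  0ℤ                                    ∎
  where open ≡-Reasoning

S-cong : ∀ k {x y} → x ≃ y → S k x ≃ S k y
S-cong k {x} {y} x≃y = mk≃ λ g → trans (pair-S k x g) (trans (≃-pair x≃y _) (sym (pair-S k y g)))

⊝-cong : ∀ {x x′ y y′} → x ≈ x′ → y ≈ y′ → x ⊝ y ≈ x′ ⊝ y′
⊝-cong {x} {x′} {y} {y′} x≈x′ y≈y′ = mk≈ λ g sk →
  trans (pair-⊝ x y g) (trans (cong₂ _-_ (≈-pair x≈x′ g sk) (≈-pair y≈y′ g sk)) (sym (pair-⊝ x′ y′ g)))

scale-cong : ∀ a {x y} → x ≈ y → scale a x ≈ scale a y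
scale-cong a {x} {y} x≈y = mk≈ λ g sk →
  trans (pair-scale a x g) (trans (cong (a *_) (≈-pair x≈y g sk)) (sym (pair-scale a y g)))

⊗-congˡ : ∀ {x x′} y → x ≈ x′ → x ⊗ y ≈ x′ ⊗ y
⊗-congˡ {x} {x′} y x≈x′ = mk≈ λ g sk →
  trans (pair-⊗ x y g) (trans (≈-pair x≈x′ _ (skew g)) (sym (pair-⊗ x′ y g)))
  where
  skew : ∀ g → Skew (λ i → ⟪ y , (λ j → g ⟦ i · j ⟧) ⟫)
  skew g i = trans (pair-congʳ y (⟦reflect·⟧ g i)) (pair-negʳ y _)

⊗-congʳ : ∀ x {y y′} → y ≈ y′ → x ⊗ y ≈ x ⊗ y′
⊗-congʳ x {y} {y′} y≈y′ = mk≈ λ g sk →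
  trans (pair-⊗ x y g) (trans (pair-congʳ x (λ i → ≈-pair y≈y′ _ (⟦·reflect⟧ sk i))) (sym (pair-⊗ x y′ g)))

⊗-cong : ∀ {x x′ y y′} → x ≈ x′ → y ≈ y′ → x ⊗ y ≈ x′ ⊗ y′
⊗-cong {x′ = x′} {y = y} x≈x′ y≈y′ = ≈.trans (⊗-congˡ y x≈x′) (⊗-congʳ x′ y≈y′)

⊗-comm : ∀ x y → x ⊗ y ≈ y ⊗ x
⊗-comm x y = mk≈ λ g sk → begin
  ⟪ x ⊗ y , g ⟫                                      ≡⟨ pair-⊗ x y g ⟩
  ⟪ x , (λ i → ⟪ y , (λ j → g ⟦ i · j ⟧) ⟫) ⟫        ≡⟨ pair-congʳ x (λ i → pair-congʳ y (⟦·⟧-comm sk i)) ⟩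
  ⟪ x , (λ i → ⟪ y , (λ j → g ⟦ j · i ⟧) ⟫) ⟫        ≡⟨ pair-comm x y (λ i j → g ⟦ j · i ⟧) ⟩
  ⟪ y , (λ j → ⟪ x , (λ i → g ⟦ j · i ⟧) ⟫) ⟫        ≡⟨ pair-⊗ y x g ⟨
  ⟪ y ⊗ x , g ⟫                                      ∎
  where open ≡-Reasoning

⊗-assoc-swap : ∀ x y z → (x ⊗ y) ⊗ z ≃ y ⊗ (x ⊗ z)
⊗-assoc-swap x y z = mk≃ λ g → begin
  ⟪ (x ⊗ y) ⊗ z , g ⟫                                                         ≡⟨ pair-⊗ (x ⊗ y) z g ⟩
  ⟪ x ⊗ y , (λ m → ⟪ z , (λ k → g ⟦ m · k ⟧) ⟫) ⟫                             ≡⟨ pair-⊗ x y _ ⟩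
  ⟪ x , (λ i → ⟪ y , (λ j → ⟪ hmul i j , (λ m → ⟪ z , (λ k → g ⟦ m · k ⟧) ⟫) ⟫) ⟫) ⟫
    ≡⟨ pair-congʳ x (λ i → pair-congʳ y (λ j → pair-comm (hmul i j) z (λ m k → g ⟦ m · k ⟧))) ⟩
  ⟪ x , (λ i → ⟪ y , (λ j → ⟪ z , (λ k → (λ m → g ⟦ m · k ⟧) ⟦ i · j ⟧) ⟫) ⟫) ⟫
    ≡⟨ pair-congʳ x (λ i → pair-congʳ y (λ j → pair-congʳ z (⟦·⟧-assoc g i j))) ⟩
  ⟪ x , (λ i → ⟪ y , (λ j → ⟪ z , (λ k → (λ m → g ⟦ j · m ⟧) ⟦ i · k ⟧) ⟫) ⟫) ⟫
    ≡⟨ pair-comm x y _ ⟩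
  ⟪ y , (λ j → ⟪ x , (λ i → ⟪ z , (λ k → (λ m → g ⟦ j · m ⟧) ⟦ i · k ⟧) ⟫) ⟫) ⟫
    ≡⟨ pair-congʳ y (λ j → pair-⊗ x z (λ m → g ⟦ j · m ⟧)) ⟨
  ⟪ y , (λ j → ⟪ x ⊗ z , (λ m → g ⟦ j · m ⟧) ⟫) ⟫                             ≡⟨ pair-⊗ y (x ⊗ z) g ⟨
  ⟪ y ⊗ (x ⊗ z) , g ⟫                                                         ∎
  where open ≡-Reasoning

⊗-distribʳ-⊝ : ∀ x y z → (x ⊝ y) ⊗ z ≃ (x ⊗ z) ⊝ (y ⊗ z)
⊗-distribʳ-⊝ x y z = mk≃ λ g → let G = λ i → ⟪ z , (λ j → g ⟦ i · j ⟧) ⟫ in begin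
  ⟪ (x ⊝ y) ⊗ z , g ⟫            ≡⟨ pair-⊗ (x ⊝ y) z g ⟩
  ⟪ x ⊝ y , G ⟫                  ≡⟨ pair-⊝ x y G ⟩
  ⟪ x , G ⟫ - ⟪ y , G ⟫          ≡⟨ cong₂ _-_ (pair-⊗ x z g) (pair-⊗ y z g) ⟨
  ⟪ x ⊗ z , g ⟫ - ⟪ y ⊗ z , g ⟫  ≡⟨ pair-⊝ (x ⊗ z) (y ⊗ z) g ⟨
  ⟪ (x ⊗ z) ⊝ (y ⊗ z) , g ⟫      ∎
  where open ≡-Reasoning

⊗-distribˡ-⊝ : ∀ x y z → z ⊗ (x ⊝ y) ≃ (z ⊗ x) ⊝ (z ⊗ y)
⊗-distribˡ-⊝ x y z = mk≃ λ g → begin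
  ⟪ z ⊗ (x ⊝ y) , g ⟫                                                          ≡⟨ pair-⊗ z (x ⊝ y) g ⟩
  ⟪ z , (λ i → ⟪ x ⊝ y , (λ j → g ⟦ i · j ⟧) ⟫) ⟫                              ≡⟨ pair-congʳ z (λ i → pair-⊝ x y _) ⟩
  ⟪ z , (λ i → ⟪ x , (λ j → g ⟦ i · j ⟧) ⟫ - ⟪ y , (λ j → g ⟦ i · j ⟧) ⟫) ⟫   ≡⟨ pair--ʳ z _ _ ⟩
  ⟪ z , (λ i → ⟪ x , (λ j → g ⟦ i · j ⟧) ⟫) ⟫ - ⟪ z , (λ i → ⟪ y , (λ j → g ⟦ i · j ⟧) ⟫) ⟫
    ≡⟨ cong₂ _-_ (pair-⊗ z x g) (pair-⊗ z y g) ⟨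
  ⟪ z ⊗ x , g ⟫ - ⟪ z ⊗ y , g ⟫                                                ≡⟨ pair-⊝ (z ⊗ x) (z ⊗ y) g ⟨
  ⟪ (z ⊗ x) ⊝ (z ⊗ y) , g ⟫                                                    ∎
  where open ≡-Reasoning

S₋₁ : CHt → CHt
S₋₁ = S (- 1ℤ)

⊗-top : ∀ x y → (x ⊗ y) ⊝ (S₋₁ x ⊗ S₋₁ y) ≃ x ⊛ y
⊗-top x y = mk≃ λ g → begin
  ⟪ (x ⊗ y) ⊝ (S₋₁ x ⊗ S₋₁ y) , g ⟫                 ≡⟨ pair-⊝ (x ⊗ y) (S₋₁ x ⊗ S₋₁ y) g ⟩
  ⟪ x ⊗ y , g ⟫ - ⟪ S₋₁ x ⊗ S₋₁ y , g ⟫             ≡⟨ cong₂ _-_ (pair-⊗ x y g) (shifted g) ⟩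
  ⟪ x , (λ i → ⟪ y , (λ j → g ⟦ i · j ⟧) ⟫) ⟫ - ⟪ x , (λ i → ⟪ y , (λ j → g ⟦ i - 1ℤ · j - 1ℤ ⟧) ⟫) ⟫
    ≡⟨ pair--ʳ x _ _ ⟨
  ⟪ x , (λ i → ⟪ y , (λ j → g ⟦ i · j ⟧) ⟫ - ⟪ y , (λ j → g ⟦ i - 1ℤ · j - 1ℤ ⟧) ⟫) ⟫
    ≡⟨ pair-congʳ x (λ i → pair--ʳ y _ _) ⟨
  ⟪ x , (λ i → ⟪ y , (λ j → g ⟦ i · j ⟧ - g ⟦ i - 1ℤ · j - 1ℤ ⟧) ⟫) ⟫
    ≡⟨ pair-congʳ x (λ i → pair-congʳ y (λ j → a≡b+c⇒a-b≡c (⟦·⟧-top g i j))) ⟩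
  ⟪ x , (λ i → ⟪ y , (λ j → g (i + j)) ⟫) ⟫        ≡⟨ pair-⊛ x y g ⟨
  ⟪ x ⊛ y , g ⟫                                     ∎
  where
  open ≡-Reasoning
  a≡b+c⇒a-b≡c : ∀ {a b c} → a ≡ b + c → a - b ≡ c
  a≡b+c⇒a-b≡c {b = b} {c} refl = ring b c
    where ring : ∀ b c → b + c - b ≡ c
          ring = solve-∀
  shifted : ∀ g → ⟪ S₋₁ x ⊗ S₋₁ y , g ⟫ ≡ ⟪ x , (λ i → ⟪ y , (λ j → g ⟦ i - 1ℤ · j - 1ℤ ⟧) ⟫) ⟫
  shifted g = trans (pair-⊗ (S₋₁ x) (S₋₁ y) g)
                (trans (pair-S (- 1ℤ) x _) (pair-congʳ x (λ i → pair-S (- 1ℤ) y _)))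

⊛-S : ∀ k x y → x ⊛ S k y ≃ S k (x ⊛ y)
⊛-S k x y = mk≃ λ g → begin
  ⟪ x ⊛ S k y , g ⟫                                    ≡⟨ pair-⊛ x (S k y) g ⟩
  ⟪ x , (λ i → ⟪ S k y , (λ j → g (i + j)) ⟫) ⟫        ≡⟨ pair-congʳ x (λ i → pair-S k y _) ⟩
  ⟪ x , (λ i → ⟪ y , (λ j → g (i + (j + k))) ⟫) ⟫      ≡⟨ pair-congʳ x (λ i → pair-congʳ y (λ j → cong g (sym (ℤ.+-assoc i j k)))) ⟩
  ⟪ x , (λ i → ⟪ y , (λ j → g (i + j + k)) ⟫) ⟫        ≡⟨ pair-⊛ x y _ ⟨
  ⟪ x ⊛ y , (λ m → g (m + k)) ⟫                        ≡⟨ pair-S k (x ⊛ y) g ⟨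
  ⟪ S k (x ⊛ y) , g ⟫                                  ∎
  where open ≡-Reasoning

⊗-S : ∀ k x y → x ⊗ S k y ≃ S k (x ⊗ y)
⊗-S k x y = mk≃ λ g → begin
  ⟪ x ⊗ S k y , g ⟫                                        ≡⟨ pair-⊗ x (S k y) g ⟩
  ⟪ x , (λ i → ⟪ S k y , (λ j → g ⟦ i · j ⟧) ⟫) ⟫          ≡⟨ pair-congʳ x (λ i → pair-S k y _) ⟩
  ⟪ x , (λ i → ⟪ y , (λ j → g ⟦ i · j + k ⟧) ⟫) ⟫          ≡⟨ pair-congʳ x (λ i → pair-congʳ y (λ j → ⟦·⟧-shift g k i j)) ⟨
  ⟪ x , (λ i → ⟪ y , (λ j → (λ m → g (m + k)) ⟦ i · j ⟧) ⟫) ⟫ ≡⟨ pair-⊗ x y _ ⟨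
  ⟪ x ⊗ y , (λ m → g (m + k)) ⟫                            ≡⟨ pair-S k (x ⊗ y) g ⟨
  ⟪ S k (x ⊗ y) , g ⟫                                      ∎
  where open ≡-Reasoning

h̃₁⊗S₋₁ : ∀ x → ht 1ℤ ⊗ S₋₁ x ≃ S₋₁ (S₋₁ x) ⊕ x
h̃₁⊗S₋₁ x = mk≃ λ g → begin
  ⟪ ht 1ℤ ⊗ S₋₁ x , g ⟫                                       ≡⟨ pair-⊗ (ht 1ℤ) (S₋₁ x) g ⟩
  ⟪ ht 1ℤ , (λ i → ⟪ S₋₁ x , (λ j → g ⟦ i · j ⟧) ⟫) ⟫         ≡⟨ pair-ht 1ℤ (λ i → ⟪ S₋₁ x , (λ j → g ⟦ i · j ⟧) ⟫) ⟩
  ⟪ S₋₁ x , (λ j → g ⟦ 1ℤ · j ⟧) ⟫                            ≡⟨ pair-S (- 1ℤ) x _ ⟩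
  ⟪ x , (λ j → g ⟦ 1ℤ · j - 1ℤ ⟧) ⟫                           ≡⟨ pair-congʳ x (λ j → ⟦1·⟧ g (j - 1ℤ)) ⟩
  ⟪ x , (λ j → g (j - 1ℤ - 1ℤ) + g (j - 1ℤ + 1ℤ)) ⟫           ≡⟨ pair-+ʳ x _ _ ⟩
  ⟪ x , (λ j → g (j - 1ℤ - 1ℤ)) ⟫ + ⟪ x , (λ j → g (j - 1ℤ + 1ℤ)) ⟫
    ≡⟨ cong₂ _+_ (sym (trans (pair-S (- 1ℤ) (S₋₁ x) g) (pair-S (- 1ℤ) x _))) (pair-congʳ x (λ j → cong g (ring j))) ⟩
  ⟪ S₋₁ (S₋₁ x) , g ⟫ + ⟪ x , g ⟫                             ≡⟨ pair-⊕ (S₋₁ (S₋₁ x)) x g ⟨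
  ⟪ S₋₁ (S₋₁ x) ⊕ x , g ⟫                                     ∎
  where
  open ≡-Reasoning
  ring : ∀ j → j - 1ℤ + 1ℤ ≡ j
  ring = solve-∀

scale2-⊝-h̃₁⊗S₋₁ : ∀ x y → scale (+ 2) (x ⊗ y) ⊝ ((ht 1ℤ ⊗ S₋₁ x) ⊗ y) ≃ (x ⊗ y) ⊝ (S₋₁ (S₋₁ x) ⊗ y)
scale2-⊝-h̃₁⊗S₋₁ x y = mk≃ λ g → let G = λ i → ⟪ y , (λ j → g ⟦ i · j ⟧) ⟫ in begin
  ⟪ scale (+ 2) (x ⊗ y) ⊝ ((ht 1ℤ ⊗ S₋₁ x) ⊗ y) , g ⟫
    ≡⟨ pair-⊝ (scale (+ 2) (x ⊗ y)) _ g ⟩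
  ⟪ scale (+ 2) (x ⊗ y) , g ⟫ - ⟪ (ht 1ℤ ⊗ S₋₁ x) ⊗ y , g ⟫
    ≡⟨ cong₂ _-_ (trans (pair-scale (+ 2) (x ⊗ y) g) (cong (+ 2 *_) (pair-⊗ x y g))) (pair-⊗ (ht 1ℤ ⊗ S₋₁ x) y g) ⟩
  + 2 * ⟪ x , G ⟫ - ⟪ ht 1ℤ ⊗ S₋₁ x , G ⟫
    ≡⟨ cong (λ a → + 2 * ⟪ x , G ⟫ - a) (trans (≃-pair (h̃₁⊗S₋₁ x) G) (pair-⊕ (S₋₁ (S₋₁ x)) x G)) ⟩
  + 2 * ⟪ x , G ⟫ - (⟪ S₋₁ (S₋₁ x) , G ⟫ + ⟪ x , G ⟫)
    ≡⟨ ring ⟪ x , G ⟫ ⟪ S₋₁ (S₋₁ x) , G ⟫ ⟩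
  ⟪ x , G ⟫ - ⟪ S₋₁ (S₋₁ x) , G ⟫
    ≡⟨ cong₂ _-_ (pair-⊗ x y g) (pair-⊗ (S₋₁ (S₋₁ x)) y g) ⟨
  ⟪ x ⊗ y , g ⟫ - ⟪ S₋₁ (S₋₁ x) ⊗ y , g ⟫
    ≡⟨ pair-⊝ (x ⊗ y) _ g ⟨
  ⟪ (x ⊗ y) ⊝ (S₋₁ (S₋₁ x) ⊗ y) , g ⟫ ∎
  where
  open ≡-Reasoning
  ring : ∀ a b → + 2 * a - (b + a) ≡ a - b
  ring = solve-∀

module _ {e₀ e₁ E : CHt} (e₀≈E : e₀ ≈ E) (e₁≈S₋₁E : e₁ ≈ S₋₁ E) where
  open import Relation.Binary.Reasoning.Setoid ≈-setoid

  err₀-step : ((e₀ ⊗ e₀) ⊝ (e₁ ⊗ e₁)) ⊗ e₀ ≈ E ⊗ (E ⊛ E)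
  err₀-step = begin
    ((e₀ ⊗ e₀) ⊝ (e₁ ⊗ e₁)) ⊗ e₀         ≈⟨ ⊗-cong (⊝-cong (⊗-cong e₀≈E e₀≈E) (⊗-cong e₁≈S₋₁E e₁≈S₋₁E)) e₀≈E ⟩
    ((E ⊗ E) ⊝ (S₋₁ E ⊗ S₋₁ E)) ⊗ E     ≈⟨ ⊗-congˡ E (≃⇒≈ (⊗-top E E)) ⟩
    (E ⊛ E) ⊗ E                         ≈⟨ ⊗-comm (E ⊛ E) E ⟩
    E ⊗ (E ⊛ E)                         ∎

  err₁-step : (scale (+ 2) (e₀ ⊗ e₀) ⊝ ((ht 1ℤ ⊗ e₁) ⊗ e₀)) ⊗ e₁ ≈ S₋₁ (E ⊗ (E ⊛ E))
  err₁-step = begin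
    (scale (+ 2) (e₀ ⊗ e₀) ⊝ ((ht 1ℤ ⊗ e₁) ⊗ e₀)) ⊗ e₁
      ≈⟨ ⊗-cong (⊝-cong (scale-cong (+ 2) (⊗-cong e₀≈E e₀≈E)) (⊗-cong (⊗-congʳ (ht 1ℤ) e₁≈S₋₁E) e₀≈E)) e₁≈S₋₁E ⟩
    (scale (+ 2) (E ⊗ E) ⊝ ((ht 1ℤ ⊗ S₋₁ E) ⊗ E)) ⊗ S₋₁ E
      ≈⟨ ⊗-congˡ (S₋₁ E) (≃⇒≈ (scale2-⊝-h̃₁⊗S₋₁ E E)) ⟩
    ((E ⊗ E) ⊝ (S₋₂E ⊗ E)) ⊗ S₋₁ E
      ≈⟨ ≃⇒≈ (⊗-distribʳ-⊝ (E ⊗ E) (S₋₂E ⊗ E) (S₋₁ E)) ⟩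
    ((E ⊗ E) ⊗ S₋₁ E) ⊝ ((S₋₂E ⊗ E) ⊗ S₋₁ E)
      ≈⟨ ⊝-cong (≃⇒≈ (⊗-assoc-swap E E (S₋₁ E))) (≃⇒≈ (⊗-assoc-swap S₋₂E E (S₋₁ E))) ⟩
    (E ⊗ (E ⊗ S₋₁ E)) ⊝ (E ⊗ (S₋₂E ⊗ S₋₁ E))
      ≈⟨ ≃⇒≈ (⊗-distribˡ-⊝ (E ⊗ S₋₁ E) (S₋₂E ⊗ S₋₁ E) E) ⟨
    E ⊗ ((E ⊗ S₋₁ E) ⊝ (S₋₂E ⊗ S₋₁ E))
      ≈⟨ ⊗-congʳ E (⊝-cong (≈.refl {E ⊗ S₋₁ E}) (⊗-comm S₋₂E (S₋₁ E))) ⟩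
    E ⊗ ((E ⊗ S₋₁ E) ⊝ (S₋₁ E ⊗ S₋₂E))
      ≈⟨ ⊗-congʳ E (≃⇒≈ (⊗-top E (S₋₁ E))) ⟩
    E ⊗ (E ⊛ S₋₁ E)
      ≈⟨ ⊗-congʳ E (≃⇒≈ (⊛-S (- 1ℤ) E E)) ⟩
    E ⊗ S₋₁ (E ⊛ E)
      ≈⟨ ≃⇒≈ (⊗-S (- 1ℤ) E (E ⊛ E)) ⟩
    S₋₁ (E ⊗ (E ⊛ E)) ∎
    where
    S₋₂E : CHt
    S₋₂E = S₋₁ (S₋₁ E)

-- Radius-value trees

Even-+ : ∀ {a b} → Even a → Even b → Even (a + b)
Even-+ (k , refl) (m , refl) = k + m , sym (ℤ.*-distribˡ-+ (+ 2) k m)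

∣k-e∣≤e : ∀ {k e} → k ℕ.≤ 2 ℕ.* e → ∣ + k - + e ∣ ℕ.≤ e
∣k-e∣≤e {k} {e} k≤2e rewrite ℤ.[+m]-[+n]≡m⊖n k e with ℕ.≤-total k e
... | inj₁ k≤e = ℕ.≤-trans (ℕ.≤-reflexive (ℤ.∣⊖∣-≤ k≤e)) (ℕ.m∸n≤m e k)
... | inj₂ e≤k rewrite ℤ.⊖-≥ e≤k =
  ℕ.≤-trans (ℕ.∸-monoˡ-≤ e k≤2e) (ℕ.≤-reflexive (trans (ℕ.m+n∸m≡n e (e ℕ.+ 0)) (ℕ.+-identityʳ e)))

∣i∣≤e⇒i≡k-e : ∀ {i e} → ∣ i ∣ ℕ.≤ e → ∃[ k ] k ℕ.≤ 2 ℕ.* e × + k - + e ≡ i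
∣i∣≤e⇒i≡k-e {+ n} {e} n≤e =
  e ℕ.+ n , ℕ.+-monoʳ-≤ e (ℕ.≤-trans n≤e (ℕ.m≤m+n e 0)) ,
  trans (cong (_- + e) (ℤ.pos-+ e n)) (ring (+ e) (+ n))
  where ring : ∀ e n → e + n - e ≡ n
        ring = solve-∀
∣i∣≤e⇒i≡k-e { -[1+ n ]} {e} 1+n≤e =
  e ℕ.∸ suc n , ℕ.≤-trans (ℕ.m∸n≤m e (suc n)) (ℕ.m≤m+n e (e ℕ.+ 0)) ,
  trans (cong (_- + e) (trans (sym (ℤ.⊖-≥ 1+n≤e)) (sym (ℤ.[+m]-[+n]≡m⊖n e (suc n))))) (ring (+ e) (+ n))
  where ring : ∀ e n → e - (1ℤ + n) - e ≡ - (1ℤ + n)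
        ring = solve-∀

∈-window⁻ : ∀ j t {l} → l ∈ window j t → ∃[ k ] k ℕ.≤ t × l ≡ j - + t + + (2 ℕ.* k)
∈-window⁻ j t l∈ with k , k∈ , refl ← ∈-map⁻ (λ k → j - + t + + (2 ℕ.* k)) l∈ = k , ℕ.≤-pred (∈-upTo⁻ k∈) , refl

∈-window⁺ : ∀ {j t k} → k ℕ.≤ t → j - + t + + (2 ℕ.* k) ∈ window j t
∈-window⁺ k≤t = ∈-map⁺ _ (∈-upTo⁺ (s≤s k≤t))

2b-2e+2k : ∀ b e k → + 2 * b - + (2 ℕ.* e) + + (2 ℕ.* k) ≡ + 2 * (b - + e + + k)
2b-2e+2k b e k rewrite ℤ.pos-* 2 e | ℤ.pos-* 2 k = ring b (+ e) (+ k)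
  where ring : ∀ b e k → + 2 * b - + 2 * e + + 2 * k ≡ + 2 * (b - e + k)
        ring = solve-∀

∈-window-even⁻ : ∀ {j l} e → Even j → l ∈ window j (2 ℕ.* e) → Even l × ∣ l - j ∣ ℕ.≤ 2 ℕ.* e
∈-window-even⁻ e (b , refl) l∈ with k , k≤2e , refl ← ∈-window⁻ (+ 2 * b) (2 ℕ.* e) l∈ =
  (b - + e + + k , 2b-2e+2k b e k) , (begin
    ∣ + 2 * b - + (2 ℕ.* e) + + (2 ℕ.* k) - + 2 * b ∣ ≡⟨ cong (λ a → ∣ a - + 2 * b ∣) (2b-2e+2k b e k) ⟩
    ∣ + 2 * (b - + e + + k) - + 2 * b ∣               ≡⟨ cong ∣_∣ (ring b (+ e) (+ k)) ⟩
    ∣ + 2 * (+ k - + e) ∣                             ≡⟨ ℤ.abs-* (+ 2) (+ k - + e) ⟩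
    2 ℕ.* ∣ + k - + e ∣                               ≤⟨ ℕ.*-monoʳ-≤ 2 (∣k-e∣≤e {k} {e} k≤2e) ⟩
    2 ℕ.* e                                           ∎)
  where
  open ℕ.≤-Reasoning
  ring : ∀ b e k → + 2 * (b - e + k) - + 2 * b ≡ + 2 * (k - e)
  ring = solve-∀

∈-window-even⁺ : ∀ {j l} e → Even j → Even l → ∣ l - j ∣ ℕ.≤ 2 ℕ.* e → l ∈ window j (2 ℕ.* e)
∈-window-even⁺ e (b , refl) (c , refl) bound =
  let k , k≤2e , k-e≡c-b = ∣i∣≤e⇒i≡k-e ∣c-b∣≤e in
  subst (_∈ window (+ 2 * b) (2 ℕ.* e)) (2c≡ k k-e≡c-b) (∈-window⁺ {+ 2 * b} k≤2e)
  where
  ring₁ : ∀ c b → + 2 * c - + 2 * b ≡ + 2 * (c - b)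
  ring₁ = solve-∀
  ∣c-b∣≤e : ∣ c - b ∣ ℕ.≤ e
  ∣c-b∣≤e = ℕ.*-cancelˡ-≤ 2 (subst (ℕ._≤ 2 ℕ.* e) (trans (cong ∣_∣ (ring₁ c b)) (ℤ.abs-* (+ 2) (c - b))) bound)
  ring₂ : ∀ b e k → + 2 * (b + (k - e)) ≡ + 2 * (b - e + k)
  ring₂ = solve-∀
  ring₃ : ∀ b c → + 2 * (b + (c - b)) ≡ + 2 * c
  ring₃ = solve-∀
  2c≡ : ∀ k → + k - + e ≡ c - b → + 2 * b - + (2 ℕ.* e) + + (2 ℕ.* k) ≡ + 2 * c
  2c≡ k k-e≡c-b = begin
    + 2 * b - + (2 ℕ.* e) + + (2 ℕ.* k) ≡⟨ 2b-2e+2k b e k ⟩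
    + 2 * (b - + e + + k)               ≡⟨ ring₂ b (+ e) (+ k) ⟨
    + 2 * (b + (+ k - + e))             ≡⟨ cong (λ d → + 2 * (b + d)) k-e≡c-b ⟩
    + 2 * (b + (c - b))                 ≡⟨ ring₃ b c ⟩
    + 2 * c                             ∎
    where open ≡-Reasoning

τℕ : ℤ → ℕ
τℕ v = ∣ v + 1ℤ ∣ ℕ.∸ 1

τ-even : ∀ {v} → Even v → ∃[ e ] τℕ v ≡ 2 ℕ.* e × τ v ≡ + (2 ℕ.* e)
τ-even (+ m , refl) = m , cong (λ x → ∣ x ∣ ℕ.∸ 1) v+1≡ , cong (λ x → + ∣ x ∣ - 1ℤ) v+1≡
  where
  v+1≡ : + 2 * + m + 1ℤ ≡ + suc (2 ℕ.* m)
  v+1≡ = trans (cong (_+ 1ℤ) (sym (ℤ.pos-* 2 m))) (cong +_ (ℕ.+-comm (2 ℕ.* m) 1))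
τ-even (-[1+ m ] , refl) = m , cong (λ x → ∣ x ∣ ℕ.∸ 1) v+1≡ , cong (λ x → + ∣ x ∣ - 1ℤ) v+1≡
  where
  v+1≡ : + 2 * -[1+ m ] + 1ℤ ≡ -[1+ 2 ℕ.* m ]
  v+1≡ rewrite ℕ.+-suc m (m ℕ.+ 0) = refl

∈-window⇔RV : ∀ {v₁ v₂ v₃ l} → Even v₁ → Even v₂ → Even v₃ →
              (l ∈ window (v₁ + v₃) (τℕ v₂) ⇔ (Even l × + ∣ l - v₁ - v₃ ∣ ℤ.≤ τ v₂))
∈-window⇔RV {v₁} {v₂} {v₃} {l} ev₁ ev₂ ev₃ with e , τℕ≡ , τ≡ ← τ-even ev₂ rewrite τℕ≡ | τ≡ =
  mk⇔ (λ l∈ → let ev , bound = ∈-window-even⁻ e (Even-+ ev₁ ev₃) l∈ in ev , ℤ.+≤+ (subst (ℕ._≤ 2 ℕ.* e) ∣∣≡ bound))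
      (λ (ev , bound) → ∈-window-even⁺ e (Even-+ ev₁ ev₃) ev (subst (ℕ._≤ 2 ℕ.* e) (sym ∣∣≡) (ℤ.drop‿+≤+ bound)))
  where
  ring : ∀ l v₁ v₃ → l - (v₁ + v₃) ≡ l - v₁ - v₃
  ring = solve-∀
  ∣∣≡ : ∣ l - (v₁ + v₃) ∣ ≡ ∣ l - v₁ - v₃ ∣
  ∣∣≡ = cong ∣_∣ (ring l v₁ v₃)

nodesOver : Tree × Tree × Tree → List Tree
nodesOver (T₁ , T₂ , T₃) = map (λ l → node l T₁ T₂ T₃) (window (val T₁ + val T₃) (τℕ (val T₂)))

grow : List Tree → List Tree
grow ts = concatMap nodesOver (cartesianProduct ts (cartesianProduct ts ts))

rvTrees : ℕ → List Tree
rvTrees zero    = leaf (+ 2) ∷ []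
rvTrees (suc n) = grow (rvTrees n)

data Grown (ts : List Tree) : Tree → Set where
  grown : ∀ {l T₁ T₂ T₃} → T₁ ∈ ts → T₂ ∈ ts → T₃ ∈ ts →
          l ∈ window (val T₁ + val T₃) (τℕ (val T₂)) → Grown ts (node l T₁ T₂ T₃)

∈-grow⁻ : ∀ ts {T} → T ∈ grow ts → Grown ts T
∈-grow⁻ ts T∈
  with (T₁ , T₂ , T₃) , t∈ , T∈nodes ← find (∈-concatMap⁻ nodesOver {xs = cartesianProduct ts (cartesianProduct ts ts)} T∈)
  with T₁∈ , T₂T₃∈ ← ∈-cartesianProduct⁻ ts (cartesianProduct ts ts) t∈
  with T₂∈ , T₃∈ ← ∈-cartesianProduct⁻ ts ts T₂T₃∈
  with l , l∈ , refl ← ∈-map⁻ (λ l → node l T₁ T₂ T₃) T∈nodes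
  = grown T₁∈ T₂∈ T₃∈ l∈

∈-grow⁺ : ∀ ts {T} → Grown ts T → T ∈ grow ts
∈-grow⁺ ts (grown {T₁ = T₁} {T₂} {T₃} T₁∈ T₂∈ T₃∈ l∈) =
  ∈-concatMap⁺ nodesOver (lose (∈-cartesianProduct⁺ T₁∈ (∈-cartesianProduct⁺ T₂∈ T₃∈)) (∈-map⁺ (λ l → node l T₁ T₂ T₃) l∈))

module _ {A B : Set} (f : A → List B) where

  unique-concatMap : ∀ {xs} → Unique xs → (∀ x → Unique (f x)) →
                     (∀ {x y z} → z ∈ f x → z ∈ f y → x ≡ y) → Unique (concatMap f xs)
  unique-concatMap []                   _        _       = []
  unique-concatMap {x ∷ xs} (x∉xs ∷ u) unique-f disjoint =
    UP.++⁺ (unique-f x) (unique-concatMap u unique-f disjoint) λ (z∈fx , z∈rest) →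
      let y , y∈xs , z∈fy = find (∈-concatMap⁻ f {xs = xs} z∈rest) in
      All.lookup x∉xs y∈xs (disjoint z∈fx z∈fy)

window-unique : ∀ j t → Unique (window j t)
window-unique j t = UP.map⁺ injective (UP.upTo⁺ (suc t))
  where
  injective : ∀ {k k′} → j - + t + + (2 ℕ.* k) ≡ j - + t + + (2 ℕ.* k′) → k ≡ k′
  injective {k} {k′} eq = ℕ.*-cancelˡ-≡ k k′ 2 (ℤ.+-injective (+-Group.∙-cancelˡ (j - + t) _ _ eq))

children : Tree → Tree × Tree × Tree
children (leaf l)           = leaf l , leaf l , leaf l
children (node _ T₁ T₂ T₃)  = T₁ , T₂ , T₃

children-nodesOver : ∀ t {T} → T ∈ nodesOver t → children T ≡ t
children-nodesOver (T₁ , T₂ , T₃) T∈ with _ , _ , refl ← ∈-map⁻ (λ l → node l T₁ T₂ T₃) T∈ = refl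

grow-unique : ∀ {ts} → Unique ts → Unique (grow ts)
grow-unique u = unique-concatMap nodesOver (UP.cartesianProduct⁺ u (UP.cartesianProduct⁺ u u))
  (λ (T₁ , T₂ , T₃) → UP.map⁺ (cong val) (window-unique (val T₁ + val T₃) (τℕ (val T₂))))
  (λ {t} {t′} T∈t T∈t′ → trans (sym (children-nodesOver t T∈t)) (children-nodesOver t′ T∈t′))

val-even : ∀ {n T} → IsRV n T → Even (val T)
val-even (rv-leaf ev)         = ev
val-even (rv-node ev _ _ _ _) = ev

grow-enumerates : ∀ {n ts} → Enumerates n ts → Enumerates (suc n) (grow ts)
grow-enumerates {n} {ts} (unique , ∈⇔RV) = grow-unique unique , λ T → mk⇔ to from
  where
  window⇔ : ∀ {T₁ T₂ T₃ l} → RV2 n T₁ → RV2 n T₂ → RV2 n T₃ →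
            (l ∈ window (val T₁ + val T₃) (τℕ (val T₂)) ⇔ (Even l × + ∣ l - val T₁ - val T₃ ∣ ℤ.≤ τ (val T₂)))
  window⇔ (rv₁ , _) (rv₂ , _) (rv₃ , _) = ∈-window⇔RV (val-even rv₁) (val-even rv₂) (val-even rv₃)

  to : ∀ {T} → T ∈ grow ts → RV2 (suc n) T
  to T∈ with grown {T₁ = T₁} {T₂} {T₃} T₁∈ T₂∈ T₃∈ l∈ ← ∈-grow⁻ ts T∈ =
    let RV₁@(rv₁ , lv₁) = Equivalence.to (∈⇔RV T₁) T₁∈
        RV₂@(rv₂ , lv₂) = Equivalence.to (∈⇔RV T₂) T₂∈
        RV₃@(rv₃ , lv₃) = Equivalence.to (∈⇔RV T₃) T₃∈
        evl , bound     = Equivalence.to (window⇔ RV₁ RV₂ RV₃) l∈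
    in rv-node evl rv₁ rv₂ rv₃ bound , lv-node lv₁ lv₂ lv₃

  from : ∀ {T} → RV2 (suc n) T → T ∈ grow ts
  from (rv-node {T₁ = T₁} {T₂} {T₃} evl rv₁ rv₂ rv₃ bound , lv-node lv₁ lv₂ lv₃) =
    ∈-grow⁺ ts (grown (Equivalence.from (∈⇔RV T₁) (rv₁ , lv₁)) (Equivalence.from (∈⇔RV T₂) (rv₂ , lv₂))
                      (Equivalence.from (∈⇔RV T₃) (rv₃ , lv₃))
                      (Equivalence.from (window⇔ (rv₁ , lv₁) (rv₂ , lv₂) (rv₃ , lv₃)) (evl , bound)))

rvTrees-enumerates : ∀ n → Enumerates n (rvTrees n)
rvTrees-enumerates zero    = (All.[] ∷ []) , λ T → mk⇔ (λ { (here refl) → rv-leaf (+ 1 , refl) , lv-leaf })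
                                                  (λ { (rv-leaf _ , lv-leaf) → here refl })
rvTrees-enumerates (suc n) = grow-enumerates (rvTrees-enumerates n)

enumerations-↭ : ∀ {n ts ts′} → Enumerates n ts → Enumerates n ts′ → ts ↭ ts′
enumerations-↭ (unique , ∈⇔RV) (unique′ , ∈⇔RV′) = ∼bag⇒↭ (unique∧set⇒bag unique unique′ λ {T} →
  mk⇔ (Equivalence.from (∈⇔RV′ T) ∘ Equivalence.to (∈⇔RV T)) (Equivalence.from (∈⇔RV T) ∘ Equivalence.to (∈⇔RV′ T)))

pair-Esum : ∀ ts g → ⟪ Esum ts , g ⟫ ≡ ∑[ T ∈ ts ] sgnT T * g (val T)
pair-Esum ts g = ∑-map (λ T → sgnT T , val T) ts (λ (c , i) → c * g i)

Esum-↭ : ∀ {ts ts′} → ts ↭ ts′ → Esum ts ≃ Esum ts′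
Esum-↭ {ts} {ts′} ts↭ts′ = mk≃ λ g →
  trans (pair-Esum ts g) (trans (∑-↭ (λ T → sgnT T * g (val T)) ts↭ts′) (sym (pair-Esum ts′ g)))

sgn-⟦τℕ·⟧ : ∀ g v j → sgn (v + 1ℤ) * g ⟦ + τℕ v · j ⟧ ≡ g ⟦ v · j ⟧
sgn-⟦τℕ·⟧ g (+ n)          j = trans (cong (λ m → sgn (+ m) * g ⟦ + (m ℕ.∸ 1) · j ⟧) (ℕ.+-comm n 1)) (ℤ.*-identityˡ _)
sgn-⟦τℕ·⟧ g -[1+ zero ]    j = refl
sgn-⟦τℕ·⟧ g -[1+ suc m ]   j = trans (ℤ.-1*i≡-i _) (sym (⟦-[1+suc]·⟧ g m j))

∑-nodesOver : ∀ g T₁ T₂ T₃ → ∑[ T ∈ nodesOver (T₁ , T₂ , T₃) ] sgnT T * g (val T)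
                            ≡ sgnT T₁ * (sgnT T₂ * (sgnT T₃ * g ⟦ val T₂ · val T₁ + val T₃ ⟧))
∑-nodesOver g T₁ T₂ T₃ = begin
  ∑[ T ∈ nodesOver (T₁ , T₂ , T₃) ] sgnT T * g (val T)   ≡⟨ ∑-map (λ l → node l T₁ T₂ T₃) (window v₁+v₃ (τℕ v₂)) (λ T → sgnT T * g (val T)) ⟩
  ∑[ l ∈ window v₁+v₃ (τℕ v₂) ] s * g l                  ≡⟨ ∑-*ˡ (window v₁+v₃ (τℕ v₂)) s g ⟩
  s * ∑ (window v₁+v₃ (τℕ v₂)) g                         ≡⟨ cong (s *_) (⟦+·⟧≡∑window g (τℕ v₂) v₁+v₃) ⟨
  s * g ⟦ + τℕ v₂ · v₁+v₃ ⟧                              ≡⟨ ring (sgn (v₂ + 1ℤ)) (sgnT T₁) (sgnT T₂) (sgnT T₃) _ ⟩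
  sgnT T₁ * (sgnT T₂ * (sgnT T₃ * (sgn (v₂ + 1ℤ) * g ⟦ + τℕ v₂ · v₁+v₃ ⟧)))
    ≡⟨ cong (λ a → sgnT T₁ * (sgnT T₂ * (sgnT T₃ * a))) (sgn-⟦τℕ·⟧ g v₂ v₁+v₃) ⟩
  sgnT T₁ * (sgnT T₂ * (sgnT T₃ * g ⟦ v₂ · v₁+v₃ ⟧))     ∎
  where
  open ≡-Reasoning
  v₂ v₁+v₃ s : ℤ
  v₂   = val T₂
  v₁+v₃ = val T₁ + val T₃
  s    = sgn (v₂ + 1ℤ) * sgnT T₁ * sgnT T₂ * sgnT T₃
  ring : ∀ σ s₁ s₂ s₃ x → σ * s₁ * s₂ * s₃ * x ≡ s₁ * (s₂ * (s₃ * (σ * x)))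
  ring = solve-∀

pair-⊗⊛ : ∀ x y z g → ⟪ x ⊗ (y ⊛ z) , g ⟫ ≡ ⟪ y , (λ i → ⟪ x , (λ j → ⟪ z , (λ k → g ⟦ j · i + k ⟧) ⟫) ⟫) ⟫
pair-⊗⊛ x y z g = begin
  ⟪ x ⊗ (y ⊛ z) , g ⟫                                                 ≡⟨ pair-⊗ x (y ⊛ z) g ⟩
  ⟪ x , (λ j → ⟪ y ⊛ z , (λ m → g ⟦ j · m ⟧) ⟫) ⟫                     ≡⟨ pair-congʳ x (λ j → pair-⊛ y z _) ⟩
  ⟪ x , (λ j → ⟪ y , (λ i → ⟪ z , (λ k → g ⟦ j · i + k ⟧) ⟫) ⟫) ⟫     ≡⟨ pair-comm x y _ ⟩
  ⟪ y , (λ i → ⟪ x , (λ j → ⟪ z , (λ k → g ⟦ j · i + k ⟧) ⟫) ⟫) ⟫     ∎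
  where open ≡-Reasoning

Esum-grow : ∀ ts → Esum (grow ts) ≃ Esum ts ⊗ (Esum ts ⊛ Esum ts)
Esum-grow ts = mk≃ λ g → let Φ = λ T → sgnT T * g (val T) ; X = λ T₁ T₂ T₃ → g ⟦ val T₂ · val T₁ + val T₃ ⟧ in begin
  ⟪ Esum (grow ts) , g ⟫                                         ≡⟨ pair-Esum (grow ts) g ⟩
  ∑ (grow ts) Φ                                                  ≡⟨ ∑-concatMap nodesOver (cartesianProduct ts (cartesianProduct ts ts)) Φ ⟩
  ∑[ t ∈ cartesianProduct ts (cartesianProduct ts ts) ] ∑ (nodesOver t) Φ
    ≡⟨ trans (∑-cartesianProduct ts _ _) (∑-cong ts (λ T₁ → ∑-cartesianProduct ts ts _)) ⟩
  ∑[ T₁ ∈ ts ] ∑[ T₂ ∈ ts ] ∑[ T₃ ∈ ts ] ∑ (nodesOver (T₁ , T₂ , T₃)) Φ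
    ≡⟨ ∑-cong ts (λ T₁ → ∑-cong ts (λ T₂ → ∑-cong ts (∑-nodesOver g T₁ T₂))) ⟩
  ∑[ T₁ ∈ ts ] ∑[ T₂ ∈ ts ] ∑[ T₃ ∈ ts ] sgnT T₁ * (sgnT T₂ * (sgnT T₃ * X T₁ T₂ T₃))
    ≡⟨ ∑-cong ts (λ T₁ → trans (∑-cong ts (λ T₂ → pull (sgnT T₁) (sgnT T₂) _)) (∑-*ˡ ts (sgnT T₁) _)) ⟩
  ∑[ T₁ ∈ ts ] sgnT T₁ * (∑[ T₂ ∈ ts ] sgnT T₂ * (∑[ T₃ ∈ ts ] sgnT T₃ * X T₁ T₂ T₃))
    ≡⟨ trans (pair-Esum ts _) (∑-cong ts λ T₁ → cong (sgnT T₁ *_) (trans (pair-Esum ts _)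
         (∑-cong ts λ T₂ → cong (sgnT T₂ *_) (pair-Esum ts _)))) ⟨
  ⟪ Esum ts , (λ i → ⟪ Esum ts , (λ j → ⟪ Esum ts , (λ k → g ⟦ j · i + k ⟧) ⟫) ⟫) ⟫
    ≡⟨ pair-⊗⊛ (Esum ts) (Esum ts) (Esum ts) g ⟨
  ⟪ Esum ts ⊗ (Esum ts ⊛ Esum ts) , g ⟫                           ∎
  where
  open ≡-Reasoning
  pull : ∀ a b (F : Tree → ℤ) → ∑[ T ∈ ts ] a * (b * F T) ≡ a * (b * ∑ ts F)
  pull a b F = trans (∑-*ˡ ts a _) (cong (a *_) (∑-*ˡ ts b F))

err≈Esum : ∀ n → err0 n ≈ Esum (rvTrees n) × err1 n ≈ S₋₁ (Esum (rvTrees n))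
err≈Esum zero    = ≈.refl , ≈.refl
err≈Esum (suc n) =
  let e₀≈E , e₁≈S₋₁E = err≈Esum n
      grown          = ≃⇒≈ (Esum-grow (rvTrees n))
      S₋₁grown       = ≃⇒≈ (S-cong (- 1ℤ) (Esum-grow (rvTrees n)))
  in ≈.trans (err₀-step e₀≈E e₁≈S₋₁E) (≈.sym grown) , ≈.trans (err₁-step e₀≈E e₁≈S₋₁E) (≈.sym S₋₁grown)

theorem5p2 : (n : ℕ) →
    (∃ λ (ts : List Tree) → Enumerates n ts) ×
    (∀ (ts : List Tree) → Enumerates n ts →
      (err0 n ≡[KerL] Esum ts) × (err1 n ≡[KerL] S -[1+ 0 ] (Esum ts)))
theorem5p2 n = (rvTrees n , rvTrees-enumerates n) , λ ts enum →
  let e₀≈E , e₁≈S₋₁E = err≈Esum n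
      E≃             = Esum-↭ (enumerations-↭ (rvTrees-enumerates n) enum)
  in ≈⇒≡[KerL] (≈.trans e₀≈E (≃⇒≈ E≃)) , ≈⇒≡[KerL] (≈.trans e₁≈S₋₁E (≃⇒≈ (S-cong (- 1ℤ) E≃)))
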